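{- Let $d\ge 2$, $0\le r\le d-1$ and $M\ge 1$ be integers. Let $N_{r,d}(M)$ be the number of distinct orbits $o(\mathbf{x})$ with $\mathbf{x}\in[0,M]^2\cap\mathbb{Z}^2$ whose length is congruent to $r\pmod d$. Here the length of $o(\mathbf{x})$ is $2\big(|2x_1-x_2|+|x_1+x_2|+|2x_2-x_1|\big)$. Then: - $N_{r,d}(M)=0$ if ($2\parallel d$ and $2\nmid r$) or ($4\mid d$ and $4\nmid r$); - $N_{r,d}(M)=\frac{1}{d}M^2+O(M)$ if $2\parallel d$ and $2\mid r$; - $N_{r,d}(M)=\frac{2}{d}M^2+O(M)$ if $4\mid d$ and $4\mid r$; - $N_{r,d}(M)=\frac{1}{2d}M^2+O(M)$ if $2\nmid d$.
   Context: On $\mathbb{Z}^2$ let $\mathcal{K}_1(x_1,x_2)=(-x_1+x_2,x_2)$ and $\mathcal{K}_2(x_1,x_2)=(x_1,x_1-x_2)$. The orbit $o(\mathbf{x})$ of $\mathbf{x}$ is the set of points obtained from $\mathbf{x}$ by alternately applying $\mathcal{K}_1$ and $\mathcal{K}_2$. Its length is the total length of the closed six-step path so obtained, which equals $2(|2x_1-x_2|+|x_1+x_2|+|2x_2-x_1|)$. The notation $2\parallel d$ means $2\mid d$ but $4\nmid d$. -}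

module Defs where

open import Data.Nat as ℕ using (ℕ; _%_; _^_)
open import Data.Integer as ℤ using (ℤ; +_; _-_; _+_; _*_; -_; ∣_∣)
import Data.Integer.Properties as ℤP
open import Data.Product using (_×_; _,_; proj₁; proj₂)
open import Data.Product.Properties using (≡-dec)
open import Data.List using (List; []; _∷_; map; concatMap; upTo; filter; deduplicate; length)
open import Data.List.Relation.Unary.All using (All; all?)
open import Data.List.Membership.DecPropositional (≡-dec ℤP._≟_ ℤP._≟_) using (_∈_; _∈?_)
open import Relation.Nullary using (Dec; ¬_)
open import Relation.Nullary.Decidable using (_×-dec_)
open import Relation.Binary.PropositionalEquality using (_≡_)

Point : Set
Point = ℤ × ℤ

K₁ : Point → Point
K₁ (x₁ , x₂) = (- x₁ + x₂ , x₂)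

K₂ : Point → Point
K₂ (x₁ , x₂) = (x₁ , x₁ - x₂)

-- The orbit o(x): all points obtained from x by alternately applying K₁ and K₂
-- (starting with either map; six alternating steps close the path).
orbit : Point → List Point
orbit x =
  x ∷ K₁ x ∷ K₂ (K₁ x) ∷ K₁ (K₂ (K₁ x)) ∷ K₂ (K₁ (K₂ (K₁ x))) ∷ K₁ (K₂ (K₁ (K₂ (K₁ x))))
  ∷ K₂ x ∷ K₁ (K₂ x) ∷ K₂ (K₁ (K₂ x)) ∷ K₁ (K₂ (K₁ (K₂ x))) ∷ K₂ (K₁ (K₂ (K₁ (K₂ x))))
  ∷ []

SameOrbit : Point → Point → Set
SameOrbit x y = All (_∈ orbit y) (orbit x) × All (_∈ orbit x) (orbit y)

sameOrbit? : (x y : Point) → Dec (SameOrbit x y)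
sameOrbit? x y = all? (_∈? orbit y) (orbit x) ×-dec all? (_∈? orbit x) (orbit y)

orbitLength : Point → ℕ
orbitLength (x₁ , x₂) =
  2 ℕ.* (∣ + 2 * x₁ - x₂ ∣ ℕ.+ ∣ x₁ + x₂ ∣ ℕ.+ ∣ + 2 * x₂ - x₁ ∣)

box : ℕ → List Point
box M = concatMap (λ i → map (λ j → (+ i , + j)) (upTo (ℕ.suc M))) (upTo (ℕ.suc M))

orbitReps : ℕ → List Point
orbitReps M = deduplicate sameOrbit? (box M)

N : ℕ → (d : ℕ) → .{{_ : ℕ.NonZero d}} → ℕ → ℕ
N r d M = length (filter (λ x → orbitLength x % d ℕ.≟ r) (orbitReps M))

-- K₁ and K₂ are involutions with (K₁K₂)³ = id, so the orbit of (a , b) is contained in the hexagon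
-- (a , b), (b - a , b), (b - a , - a), (- b , - a), (- b , a - b), (a , a - b), and the length is an
-- orbit invariant. Hence every orbit meeting [0,M]² meets it in exactly one representative (i , j):
-- either i = j, or 0 < i ≤ j/2, or 0 < j ≤ i/2. Their lengths are 8i, 4(2j - i) and 4(2i - j), all
-- divisible by 4, which gives the vanishing cases. The diagonal contributes O(M), and the two
-- triangles are exchanged by (i , j) ↦ (j , i), which preserves the length. In row i of the lower
-- triangle the condition 4(2i - j) ≡ r (mod d) becomes w(2i - j) ≡ s (mod m), where (m , w) is
-- (d , 4), (d/2 , 2) or (d/4 , 1) and w is invertible modulo m: a single residue class of j modulo m.
-- So row i contributes ⌊i/2⌋/m + O(1), and 4 ∑_{i ≤ M} ⌊i/2⌋ = M² + O(M) gives 2mN = M² + O(M).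
module Submission where

open import Defs
open import Data.Nat using (ℕ; NonZero; _<_)
import Data.Nat as ℕ
open import Data.Nat.Divisibility using (_∣_)
open import Function using (_⇔_)
open import Relation.Binary.PropositionalEquality using (_≡_)
open import Relation.Binary.Bundles using (Setoid)

module Sums where

  open import Data.Nat
  open import Data.Nat.Properties
  open import Data.Nat.Tactic.RingSolver using (solve-∀)
  open import Data.Product using (_,_)
  open import Data.Empty using (⊥-elim)
  open import Function using (_∘_; _⇔_; Equivalence)
  open import Relation.Nullary using (Dec; yes; no; ¬_)
  open import Relation.Nullary.Decidable using (_×-dec_; _⊎-dec_)
  open import Relation.Unary using (Pred; Decidable)
  open import Relation.Binary.PropositionalEquality
  import Algebra.Properties.CommutativeSemigroup +-commutativeSemigroup as +-CS

  ∑ : ℕ → (ℕ → ℕ) → ℕ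
  ∑ zero    f = 0
  ∑ (suc n) f = f 0 + ∑ n (f ∘ suc)

  syntax ∑ n (λ k → e) = ∑[ k < n ] e

  𝟙[_] : ∀ {A : Set} → Dec A → ℕ
  𝟙[ yes _ ] = 1
  𝟙[ no _ ]  = 0

  ∑-cong : ∀ n {f g} → (∀ {k} → k < n → f k ≡ g k) → ∑ n f ≡ ∑ n g
  ∑-cong zero    eq = refl
  ∑-cong (suc n) eq = cong₂ _+_ (eq z<s) (∑-cong n (eq ∘ s<s))

  ∑-mono-≤ : ∀ n {f g} → (∀ {k} → k < n → f k ≤ g k) → ∑ n f ≤ ∑ n g
  ∑-mono-≤ zero    le = z≤n
  ∑-mono-≤ (suc n) le = +-mono-≤ (le z<s) (∑-mono-≤ n (le ∘ s<s))

  ∑-const : ∀ n c → ∑[ _ < n ] c ≡ n * c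
  ∑-const zero    c = refl
  ∑-const (suc n) c = cong (c +_) (∑-const n c)

  ∑-zero : ∀ n {f} → (∀ {k} → k < n → f k ≡ 0) → ∑ n f ≡ 0
  ∑-zero n f≡0 = trans (∑-cong n f≡0) (trans (∑-const n 0) (*-zeroʳ n))

  ∑-distrib-+ : ∀ n f g → ∑[ k < n ] (f k + g k) ≡ ∑ n f + ∑ n g
  ∑-distrib-+ zero    f g = refl
  ∑-distrib-+ (suc n) f g = trans (cong (f 0 + g 0 +_) (∑-distrib-+ n (f ∘ suc) (g ∘ suc)))
                                  (+-CS.interchange (f 0) (g 0) (∑ n (f ∘ suc)) (∑ n (g ∘ suc)))

  ∑²-distrib-+ : ∀ n (f g : ℕ → ℕ → ℕ) →
    ∑[ i < n ] ∑[ j < n ] (f i j + g i j) ≡ ∑[ i < n ] ∑[ j < n ] f i j + ∑[ i < n ] ∑[ j < n ] g i j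
  ∑²-distrib-+ n f g = trans (∑-cong n λ {i} _ → ∑-distrib-+ n (f i) (g i)) (∑-distrib-+ n _ _)

  *-distribˡ-∑ : ∀ c n f → c * ∑ n f ≡ ∑[ k < n ] (c * f k)
  *-distribˡ-∑ c zero    f = *-zeroʳ c
  *-distribˡ-∑ c (suc n) f = trans (*-distribˡ-+ c (f 0) _) (cong (c * f 0 +_) (*-distribˡ-∑ c n (f ∘ suc)))

  ∑-split : ∀ m n f → ∑ (m + n) f ≡ ∑ m f + ∑[ k < n ] f (m + k)
  ∑-split zero    n f = refl
  ∑-split (suc m) n f = trans (cong (f 0 +_) (∑-split m n (f ∘ suc))) (sym (+-assoc (f 0) _ _))

  ∑-last : ∀ n f → ∑ (suc n) f ≡ ∑ n f + f n
  ∑-last zero    f = +-identityʳ (f 0)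
  ∑-last (suc n) f = trans (cong (f 0 +_) (∑-last n (f ∘ suc))) (sym (+-assoc (f 0) _ _))

  ∑-prefix-≤ : ∀ {t n} f → t ≤ n → ∑ t f ≤ ∑ n f
  ∑-prefix-≤ {t} f t≤n with m≤n⇒∃[o]m+o≡n t≤n
  ... | p , refl = ≤-trans (m≤m+n (∑ t f) _) (≤-reflexive (sym (∑-split t p f)))

  term≤∑ : ∀ n f {k} → k < n → f k ≤ ∑ n f
  term≤∑ (suc n) f {zero}  _         = m≤m+n (f 0) _
  term≤∑ (suc n) f {suc k} (s<s k<n) = ≤-trans (term≤∑ n (f ∘ suc) k<n) (m≤n+m _ (f 0))

  ∑-swap : ∀ m n (f : ℕ → ℕ → ℕ) → ∑[ i < m ] ∑[ j < n ] f i j ≡ ∑[ j < n ] ∑[ i < m ] f i j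
  ∑-swap zero    n f = sym (∑-zero n λ _ → refl)
  ∑-swap (suc m) n f = trans (cong (∑ n (f 0) +_) (∑-swap m n (f ∘ suc)))
                             (sym (∑-distrib-+ n (f 0) (λ j → ∑[ i < m ] f (suc i) j)))

  ∑≡n⇒all≡1 : ∀ n f → (∀ {k} → k < n → f k ≤ 1) → ∑ n f ≡ n → ∀ {k} → k < n → f k ≡ 1
  ∑≡n⇒all≡1 (suc n) f f≤1 ∑≡n {k} k<n with f 0 in f0≡ | f≤1 {0} z<s
  ... | 0 | _ = ⊥-elim (<⇒≱ (n<1+n n) (begin
    suc n         ≡⟨ ∑≡n ⟨
    ∑ n (f ∘ suc) ≤⟨ ∑-mono-≤ n {g = λ _ → 1} (f≤1 ∘ s<s) ⟩
    ∑[ _ < n ] 1  ≡⟨ trans (∑-const n 1) (*-identityʳ n) ⟩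
    n             ∎))
    where open ≤-Reasoning
  ... | 1 | _ with k
  ...   | zero   = f0≡
  ...   | suc k′ = ∑≡n⇒all≡1 n (f ∘ suc) (f≤1 ∘ s<s) (suc-injective ∑≡n) (s<s⁻¹ k<n)
  ∑≡n⇒all≡1 (suc n) f f≤1 ∑≡n {k} k<n | 2+ _ | s≤s ()

  𝟙≤1 : ∀ {A : Set} (a : Dec A) → 𝟙[ a ] ≤ 1
  𝟙≤1 (yes _) = ≤-refl
  𝟙≤1 (no _)  = z≤n

  m*𝟙≤m : ∀ m {A : Set} (a : Dec A) → m * 𝟙[ a ] ≤ m
  m*𝟙≤m m a = ≤-trans (*-monoʳ-≤ m (𝟙≤1 a)) (≤-reflexive (*-identityʳ m))

  𝟙-≡0 : ∀ {A : Set} (a : Dec A) → ¬ A → 𝟙[ a ] ≡ 0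
  𝟙-≡0 (yes x) ¬x = ⊥-elim (¬x x)
  𝟙-≡0 (no _)  _  = refl

  𝟙-≡1 : ∀ {A : Set} (a : Dec A) → A → 𝟙[ a ] ≡ 1
  𝟙-≡1 (yes _) _ = refl
  𝟙-≡1 (no ¬x) x = ⊥-elim (¬x x)

  𝟙-cong : ∀ {A B : Set} (a : Dec A) (b : Dec B) → A ⇔ B → 𝟙[ a ] ≡ 𝟙[ b ]
  𝟙-cong (yes x) b A⇔B = sym (𝟙-≡1 b (Equivalence.to A⇔B x))
  𝟙-cong (no ¬x) b A⇔B = sym (𝟙-≡0 b (¬x ∘ Equivalence.from A⇔B))

  𝟙-× : ∀ {A B : Set} (a : Dec A) (b : Dec B) → 𝟙[ a ×-dec b ] ≡ 𝟙[ a ] * 𝟙[ b ]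
  𝟙-× (yes _) (yes _) = refl
  𝟙-× (yes _) (no _)  = refl
  𝟙-× (no _)  _       = refl

  𝟙-⊎ : ∀ {A B : Set} (a : Dec A) (b : Dec B) → (A → ¬ B) → 𝟙[ a ⊎-dec b ] ≡ 𝟙[ a ] + 𝟙[ b ]
  𝟙-⊎ (yes x) (yes y) A⇒¬B = ⊥-elim (A⇒¬B x y)
  𝟙-⊎ (yes _) (no _)  _    = refl
  𝟙-⊎ (no _)  (yes _) _    = refl
  𝟙-⊎ (no _)  (no _)  _    = refl

  ∑-𝟙≤1 : ∀ n {P : Pred ℕ _} (P? : Decidable P) → (∀ {j k} → j < n → k < n → P j → P k → j ≡ k) →
          ∑[ k < n ] 𝟙[ P? k ] ≤ 1
  ∑-𝟙≤1 zero    P? unique = z≤n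
  ∑-𝟙≤1 (suc n) P? unique with P? 0
  ... | yes p0 = ≤-reflexive (cong suc (∑-zero n λ {k} k<n →
                   𝟙-≡0 (P? (suc k)) λ pk → 0≢1+n (unique z<s (s<s k<n) p0 pk)))
  ... | no _   = ∑-𝟙≤1 n (P? ∘ suc) λ j<n k<n pj pk → suc-injective (unique (s<s j<n) (s<s k<n) pj pk)

  ∑-𝟙-≟ : ∀ n {i} → i < n → ∑[ k < n ] 𝟙[ i ≟ k ] ≡ 1
  ∑-𝟙-≟ n {i} i<n = ≤-antisym (∑-𝟙≤1 n (i ≟_) λ _ _ i≡j i≡k → trans (sym i≡j) i≡k)
                              (≤-trans (≤-reflexive (sym (𝟙-≡1 (i ≟ i) refl))) (term≤∑ n (λ k → 𝟙[ i ≟ k ]) i<n))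

  ∑-restrict : ∀ {h n} f → h ≤ n → ∑[ k < n ] (𝟙[ k <? h ] * f k) ≡ ∑ h f
  ∑-restrict {h} f h≤n with m≤n⇒∃[o]m+o≡n h≤n
  ... | p , refl = begin
    ∑[ k < h + p ] (𝟙[ k <? h ] * f k)                                         ≡⟨ ∑-split h p _ ⟩
    ∑[ k < h ] (𝟙[ k <? h ] * f k) + ∑[ k < p ] (𝟙[ h + k <? h ] * f (h + k)) ≡⟨ cong₂ _+_ inside outside ⟩
    ∑ h f + 0                                                                  ≡⟨ +-identityʳ _ ⟩
    ∑ h f                                                                      ∎
    where
    open ≡-Reasoning
    inside : ∑[ k < h ] (𝟙[ k <? h ] * f k) ≡ ∑ h f
    inside = ∑-cong h λ {k} k<h → trans (cong (_* f k) (𝟙-≡1 (k <? h) k<h)) (*-identityˡ (f k))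
    outside : ∑[ k < p ] (𝟙[ h + k <? h ] * f (h + k)) ≡ 0
    outside = ∑-zero p λ {k} _ → cong (_* f (h + k)) (𝟙-≡0 (h + k <? h) (≤⇒≯ (m≤m+n h k)))

  ∣m+n-n∣≡m : ∀ m n → ∣ m + n - n ∣ ≡ m
  ∣m+n-n∣≡m m n = trans (cong₂ ∣_-_∣ (+-comm m n) (sym (+-identityʳ n)))
                        (trans (∣m+n-m+o∣≡∣n-o∣ n m 0) (∣-∣-identityʳ m))

  ∣-∣-+ : ∀ a b c e → ∣ a + b - c + e ∣ ≤ ∣ a - c ∣ + ∣ b - e ∣
  ∣-∣-+ a b c e = begin
    ∣ a + b - c + e ∣                     ≤⟨ ∣-∣-triangle (a + b) (c + b) (c + e) ⟩
    ∣ a + b - c + b ∣ + ∣ c + b - c + e ∣ ≡⟨ cong₂ _+_ cancel-b (∣m+n-m+o∣≡∣n-o∣ c b e) ⟩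
    ∣ a - c ∣ + ∣ b - e ∣                 ∎
    where
    open ≤-Reasoning
    cancel-b : ∣ a + b - c + b ∣ ≡ ∣ a - c ∣
    cancel-b = trans (cong₂ ∣_-_∣ (+-comm a b) (+-comm c b)) (∣m+n-m+o∣≡∣n-o∣ b a c)

  ∑-∣-∣ : ∀ n f g → ∣ ∑ n f - ∑ n g ∣ ≤ ∑[ k < n ] ∣ f k - g k ∣
  ∑-∣-∣ zero    f g = z≤n
  ∑-∣-∣ (suc n) f g = ≤-trans (∣-∣-+ (f 0) _ (g 0) _) (+-monoʳ-≤ ∣ f 0 - g 0 ∣ (∑-∣-∣ n (f ∘ suc) (g ∘ suc)))

  ≤⌊/2⌋⇒+≤ : ∀ {j n} → j ≤ ⌊ n /2⌋ → j + j ≤ n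
  ≤⌊/2⌋⇒+≤ {n = n} j≤h = ≤-trans (+-mono-≤ j≤h (≤-trans j≤h (⌊n/2⌋≤⌈n/2⌉ n))) (≤-reflexive (⌊n/2⌋+⌈n/2⌉≡n n))

  +≤⇒≤⌊/2⌋ : ∀ {j n} → j + j ≤ n → j ≤ ⌊ n /2⌋
  +≤⇒≤⌊/2⌋ {j} j+j≤n = ≤-trans (≤-reflexive (n≡⌊n+n/2⌋ j)) (⌊n/2⌋-mono j+j≤n)

  ∑⌊/2⌋-step : ∀ n → ∑[ i < 2 + n ] ⌊ i /2⌋ ≡ ∑[ i < n ] ⌊ i /2⌋ + n
  ∑⌊/2⌋-step n = begin
    ∑[ i < 2 + n ] ⌊ i /2⌋                   ≡⟨ ∑-last (suc n) ⌊_/2⌋ ⟩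
    ∑[ i < 1 + n ] ⌊ i /2⌋ + ⌈ n /2⌉         ≡⟨ cong (_+ ⌈ n /2⌉) (∑-last n ⌊_/2⌋) ⟩
    ∑[ i < n ] ⌊ i /2⌋ + ⌊ n /2⌋ + ⌈ n /2⌉   ≡⟨ +-assoc (∑ n ⌊_/2⌋) ⌊ n /2⌋ ⌈ n /2⌉ ⟩
    ∑[ i < n ] ⌊ i /2⌋ + (⌊ n /2⌋ + ⌈ n /2⌉) ≡⟨ cong (∑ n ⌊_/2⌋ +_) (⌊n/2⌋+⌈n/2⌉≡n n) ⟩
    ∑[ i < n ] ⌊ i /2⌋ + n                   ∎
    where open ≡-Reasoning

  ∑⌊/2⌋-approx : ∀ n → ∣ 4 * ∑[ i < n ] ⌊ i /2⌋ + 2 * n - n * n ∣ ≤ 1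
  ∑⌊/2⌋-approx zero          = z≤n
  ∑⌊/2⌋-approx (suc zero)    = ≤-refl
  ∑⌊/2⌋-approx (suc (suc n)) = begin
    ∣ 4 * ∑[ i < 2 + n ] ⌊ i /2⌋ + 2 * (2 + n) - (2 + n) * (2 + n) ∣
      ≡⟨ cong (λ h → ∣ 4 * h + 2 * (2 + n) - (2 + n) * (2 + n) ∣) (∑⌊/2⌋-step n) ⟩
    ∣ 4 * (∑[ i < n ] ⌊ i /2⌋ + n) + 2 * (2 + n) - (2 + n) * (2 + n) ∣
      ≡⟨ cong₂ ∣_-_∣ (left (∑ n ⌊_/2⌋) n) (right n) ⟩
    ∣ (4 * n + 4) + (4 * ∑[ i < n ] ⌊ i /2⌋ + 2 * n) - (4 * n + 4) + n * n ∣
      ≡⟨ ∣m+n-m+o∣≡∣n-o∣ (4 * n + 4) _ _ ⟩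
    ∣ 4 * ∑[ i < n ] ⌊ i /2⌋ + 2 * n - n * n ∣
      ≤⟨ ∑⌊/2⌋-approx n ⟩
    1 ∎
    where
    open ≤-Reasoning
    left : ∀ h n → 4 * (h + n) + 2 * (2 + n) ≡ (4 * n + 4) + (4 * h + 2 * n)
    left = solve-∀
    right : ∀ n → (2 + n) * (2 + n) ≡ (4 * n + 4) + n * n
    right = solve-∀

  ∑⌊/2⌋-approx-M² : ∀ M → ∣ 2 * suc M + 4 * ∑[ i < suc M ] ⌊ i /2⌋ - M * M ∣ ≤ 2 * M + 2
  ∑⌊/2⌋-approx-M² M = begin
    ∣ 2 * n + 4 * H - M * M ∣                     ≤⟨ ∣-∣-triangle (2 * n + 4 * H) (n * n) (M * M) ⟩
    ∣ 2 * n + 4 * H - n * n ∣ + ∣ n * n - M * M ∣ ≡⟨ cong₂ _+_ (cong (∣_- n * n ∣) (+-comm (2 * n) (4 * H))) n*n-M*M ⟩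
    ∣ 4 * H + 2 * n - n * n ∣ + (2 * M + 1)       ≤⟨ +-monoˡ-≤ (2 * M + 1) (∑⌊/2⌋-approx n) ⟩
    1 + (2 * M + 1)                               ≡⟨ rearrange M ⟩
    2 * M + 2                                     ∎
    where
    open ≤-Reasoning
    n = suc M
    H = ∑[ i < n ] ⌊ i /2⌋
    square : ∀ M → suc M * suc M ≡ (2 * M + 1) + M * M
    square = solve-∀
    rearrange : ∀ M → 1 + (2 * M + 1) ≡ 2 * M + 2
    rearrange = solve-∀
    n*n-M*M : ∣ n * n - M * M ∣ ≡ 2 * M + 1
    n*n-M*M = trans (cong (∣_- M * M ∣) (square M)) (∣m+n-n∣≡m (2 * M + 1) (M * M))

module ResiduesOfProgressions (m : ℕ) .{{_ : NonZero m}} (u : ℕ) (u-cancel : ∀ {δ} → m ∣ u ℕ.* δ → m ∣ δ) where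

  open Sums
  open import Data.Nat
  open import Data.Nat.Properties
  open import Data.Nat.DivMod using (m≡m%n+[m/n]*n; m%n<n)
  open import Data.Nat.Divisibility using (_∣_; ∣m+n∣m⇒∣n; n∣m*n; ∣⇒≤)
  open import Data.Product using (_,_)
  open import Data.Sum using (inj₁; inj₂)
  open import Data.Empty using (⊥-elim)
  open import Relation.Binary.PropositionalEquality

  %-≡⇒∣ : ∀ x y → (x + y) % m ≡ x % m → m ∣ y
  %-≡⇒∣ x y eq = ∣m+n∣m⇒∣n (subst (m ∣_) quotients (n∣m*n ((x + y) / m))) (n∣m*n (x / m))
    where
    open ≡-Reasoning
    quotients : (x + y) / m * m ≡ x / m * m + y
    quotients = +-cancelˡ-≡ (x % m) _ _ (begin
      x % m + (x + y) / m * m       ≡⟨ cong (_+ (x + y) / m * m) eq ⟨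
      (x + y) % m + (x + y) / m * m ≡⟨ m≡m%n+[m/n]*n (x + y) m ⟨
      x + y                         ≡⟨ cong (_+ y) (m≡m%n+[m/n]*n x m) ⟩
      x % m + x / m * m + y         ≡⟨ +-assoc (x % m) _ y ⟩
      x % m + (x / m * m + y)       ∎)

  ∣∧<⇒≡0 : ∀ {δ} → m ∣ δ → δ < m → δ ≡ 0
  ∣∧<⇒≡0 {zero}  _   _   = refl
  ∣∧<⇒≡0 {suc δ} m∣δ δ<m = ⊥-elim (<⇒≱ δ<m (∣⇒≤ m∣δ))

  progression-injective-≤ : ∀ c {j k} → j ≤ k → k < m → (c + u * j) % m ≡ (c + u * k) % m → j ≡ k
  progression-injective-≤ c {j} j≤k k<m eq with m≤n⇒∃[o]m+o≡n j≤k
  ... | δ , refl = sym (trans (cong (j +_) δ≡0) (+-identityʳ j))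
    where
    shift : c + u * (j + δ) ≡ c + u * j + u * δ
    shift = trans (cong (c +_) (*-distribˡ-+ u j δ)) (sym (+-assoc c _ _))
    δ≡0 : δ ≡ 0
    δ≡0 = ∣∧<⇒≡0 (u-cancel (%-≡⇒∣ (c + u * j) (u * δ) (trans (cong (_% m) (sym shift)) (sym eq))))
                 (≤-<-trans (m≤n+m δ j) k<m)

  progression-injective : ∀ c {j k} → j < m → k < m → (c + u * j) % m ≡ (c + u * k) % m → j ≡ k
  progression-injective c {j} {k} j<m k<m eq with ≤-total j k
  ... | inj₁ j≤k = progression-injective-≤ c j≤k k<m eq
  ... | inj₂ k≤j = sym (progression-injective-≤ c k≤j j<m (sym eq))

  hits : ℕ → ℕ → ℕ → ℕ
  hits c s n = ∑[ k < n ] 𝟙[ (c + u * k) % m ≟ s ]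

  hits-period : ∀ c {s} → s < m → hits c s m ≡ 1
  hits-period c s<m = ∑≡n⇒all≡1 m (λ s → hits c s m) (λ _ → hits≤1 _) total s<m
    where
    open ≡-Reasoning
    hits≤1 : ∀ s → hits c s m ≤ 1
    hits≤1 s = ∑-𝟙≤1 m (λ k → (c + u * k) % m ≟ s)
                 λ j<m k<m hit-j hit-k → progression-injective c j<m k<m (trans hit-j (sym hit-k))
    total : ∑[ s < m ] hits c s m ≡ m
    total = begin
      ∑[ s < m ] ∑[ k < m ] 𝟙[ (c + u * k) % m ≟ s ] ≡⟨ ∑-swap m m (λ s k → 𝟙[ (c + u * k) % m ≟ s ]) ⟩
      ∑[ k < m ] ∑[ s < m ] 𝟙[ (c + u * k) % m ≟ s ] ≡⟨ ∑-cong m (λ _ → ∑-𝟙-≟ m (m%n<n _ m)) ⟩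
      ∑[ k < m ] 1                                   ≡⟨ trans (∑-const m 1) (*-identityʳ m) ⟩
      m                                              ∎

  hits-+-period : ∀ c {s} → s < m → ∀ n → hits c s (n + m) ≡ hits c s n + 1
  hits-+-period c {s} s<m n = begin
    hits c s (n + m)                                       ≡⟨ ∑-split n m _ ⟩
    hits c s n + ∑[ k < m ] 𝟙[ (c + u * (n + k)) % m ≟ s ] ≡⟨ cong (hits c s n +_) shifted ⟩
    hits c s n + hits (c + u * n) s m                      ≡⟨ cong (hits c s n +_) (hits-period (c + u * n) s<m) ⟩
    hits c s n + 1                                         ∎
    where
    open ≡-Reasoning
    shifted : ∑[ k < m ] 𝟙[ (c + u * (n + k)) % m ≟ s ] ≡ hits (c + u * n) s m
    shifted = ∑-cong m λ {k} _ → cong (λ x → 𝟙[ x % m ≟ s ])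
                                      (trans (cong (c +_) (*-distribˡ-+ u n k)) (sym (+-assoc c _ _)))

  hits-+-periods : ∀ c {s} → s < m → ∀ t q → hits c s (t + q * m) ≡ hits c s t + q
  hits-+-periods c s<m t zero        = trans (cong (hits c _) (+-identityʳ t)) (sym (+-identityʳ _))
  hits-+-periods c {s} s<m t (suc q) = begin
    hits c s (t + (m + q * m)) ≡⟨ cong (hits c s) (trans (cong (t +_) (+-comm m (q * m))) (sym (+-assoc t _ m))) ⟩
    hits c s (t + q * m + m)   ≡⟨ hits-+-period c s<m (t + q * m) ⟩
    hits c s (t + q * m) + 1   ≡⟨ cong (_+ 1) (hits-+-periods c s<m t q) ⟩
    hits c s t + q + 1         ≡⟨ trans (+-assoc (hits c s t) q 1) (cong (hits c s t +_) (+-comm q 1)) ⟩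
    hits c s t + suc q         ∎
    where open ≡-Reasoning

  hits-approx : ∀ c {s} → s < m → ∀ n → ∣ m * hits c s n - n ∣ ≤ m
  hits-approx c {s} s<m n = subst (λ n → ∣ m * hits c s n - n ∣ ≤ m) (sym (m≡m%n+[m/n]*n n m))
                                  (decomposed (n % m) (n / m) (m%n<n n m))
    where
    open ≤-Reasoning
    decomposed : ∀ t q → t < m → ∣ m * hits c s (t + q * m) - (t + q * m) ∣ ≤ m
    decomposed t q t<m = begin
      ∣ m * hits c s (t + q * m) - (t + q * m) ∣ ≡⟨ cong (λ h → ∣ m * h - (t + q * m) ∣) (hits-+-periods c s<m t q) ⟩
      ∣ m * (hits c s t + q) - (t + q * m) ∣     ≡⟨ cong (λ h → ∣ h - (t + q * m) ∣) (*-distribˡ-+ m (hits c s t) q) ⟩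
      ∣ m * hits c s t + m * q - (t + q * m) ∣   ≤⟨ ∣-∣-+ (m * hits c s t) (m * q) t (q * m) ⟩
      ∣ m * hits c s t - t ∣ + ∣ m * q - q * m ∣ ≡⟨ cong (∣ m * hits c s t - t ∣ +_) periods-cancel ⟩
      ∣ m * hits c s t - t ∣ + 0                 ≡⟨ +-identityʳ _ ⟩
      ∣ m * hits c s t - t ∣                     ≤⟨ ∣m-n∣≤m⊔n (m * hits c s t) t ⟩
      m * hits c s t ⊔ t                         ≤⟨ ⊔-lub m*hits≤m (<⇒≤ t<m) ⟩
      m                                          ∎
      where
      periods-cancel : ∣ m * q - q * m ∣ ≡ 0
      periods-cancel = trans (cong (∣ m * q -_∣) (*-comm q m)) (∣n-n∣≡0 (m * q))
      m*hits≤m : m * hits c s t ≤ m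
      m*hits≤m = ≤-trans (*-monoʳ-≤ m (≤-trans (∑-prefix-≤ _ (<⇒≤ t<m)) (≤-reflexive (hits-period c s<m))))
                         (≤-reflexive (*-identityʳ m))

module UniqueLists {a ℓ} (S : Setoid a ℓ) where

  open Setoid S
  open import Data.Nat using (_≤_; z≤n; s≤s; suc)
  open import Data.Nat.Properties using (module ≤-Reasoning)
  open import Data.List using ([]; _∷_; length)
  open import Data.List.Properties using (length-removeAt′)
  open import Data.List.Relation.Unary.Any using (here; there; index; _─_)
  open import Data.List.Membership.Setoid S using (_∈_)
  open import Data.List.Membership.Setoid.Properties using (∈-resp-≈; All[≉]⇒∉)
  open import Data.List.Relation.Binary.Subset.Setoid S using (_⊆_)
  open import Data.List.Relation.Unary.Unique.Setoid S using (Unique; _∷_)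
  open import Data.Empty using (⊥-elim)
  open import Relation.Nullary using (¬_)

  ∈-─ : ∀ {x z ys} (x∈ys : x ∈ ys) → z ∈ ys → ¬ z ≈ x → z ∈ (ys ─ x∈ys)
  ∈-─ (here x≈y) (here z≈y) z≉x = ⊥-elim (z≉x (trans z≈y (sym x≈y)))
  ∈-─ (here _)   (there z∈) _   = z∈
  ∈-─ (there _)  (here z≈y) _   = here z≈y
  ∈-─ (there p)  (there z∈) z≉x = there (∈-─ p z∈ z≉x)

  Unique-⊆⇒length≤ : ∀ {xs ys} → Unique xs → xs ⊆ ys → length xs ≤ length ys
  Unique-⊆⇒length≤ {[]}                _            _        = z≤n
  Unique-⊆⇒length≤ {x ∷ xs} {ys} (x≉xs ∷ xs!) x∷xs⊆ys = begin
    suc (length xs)          ≤⟨ s≤s (Unique-⊆⇒length≤ xs! xs⊆ys─x) ⟩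
    suc (length (ys ─ x∈ys)) ≡⟨ length-removeAt′ ys (index x∈ys) ⟨
    length ys                ∎
    where
    open ≤-Reasoning
    x∈ys : x ∈ ys
    x∈ys = x∷xs⊆ys (here refl)
    xs⊆ys─x : xs ⊆ (ys ─ x∈ys)
    xs⊆ys─x z∈xs = ∈-─ x∈ys (x∷xs⊆ys (there z∈xs)) λ z≈x → All[≉]⇒∉ S x≉xs (∈-resp-≈ S z≈x z∈xs)

module Orbit where

  import Data.Nat as ℕ
  import Data.Nat.Properties as ℕ
  open import Data.Integer as ℤ using (+_; -_; _+_; _-_; _*_; ∣_∣)
  import Data.Integer.Properties as ℤ
  open import Data.Integer.Tactic.RingSolver using (solve-∀)
  open import Data.Product using (_,_)
  open import Data.List.Relation.Unary.All as All using (All; []; _∷_)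
  open import Data.List.Relation.Unary.Any using (here; there)
  open import Data.List.Membership.Propositional using (_∈_)
  open import Relation.Binary.PropositionalEquality
  import Algebra.Properties.CommutativeSemigroup ℕ.+-commutativeSemigroup as +-CS

  K₁-involutive : ∀ x → K₁ (K₁ x) ≡ x
  K₁-involutive (a , b) = cong (_, b) (identity a b)
    where identity : ∀ a b → - (- a + b) + b ≡ a
          identity = solve-∀

  K₂-involutive : ∀ x → K₂ (K₂ x) ≡ x
  K₂-involutive (a , b) = cong (a ,_) (identity a b)
    where identity : ∀ a b → a - (a - b) ≡ b
          identity = solve-∀

  K₁K₂-rotation : ∀ a b → K₁ (K₂ (a , b)) ≡ (- b , a - b)
  K₁K₂-rotation a b = cong (_, a - b) (identity a b)
    where identity : ∀ a b → - a + (a - b) ≡ - b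
          identity = solve-∀

  [K₁K₂]³≡id : ∀ x → K₁ (K₂ (K₁ (K₂ (K₁ (K₂ x))))) ≡ x
  [K₁K₂]³≡id (a , b) = begin
    K₁ (K₂ (K₁ (K₂ (K₁ (K₂ (a , b)))))) ≡⟨ cong (λ y → K₁ (K₂ (K₁ (K₂ y)))) (K₁K₂-rotation a b) ⟩
    K₁ (K₂ (K₁ (K₂ (- b , a - b))))     ≡⟨ cong (λ y → K₁ (K₂ y)) (K₁K₂-rotation (- b) (a - b)) ⟩
    K₁ (K₂ (- (a - b) , - b - (a - b))) ≡⟨ K₁K₂-rotation (- (a - b)) (- b - (a - b)) ⟩
    (- (- b - (a - b)) , - (a - b) - (- b - (a - b))) ≡⟨ cong₂ _,_ (first a b) (second a b) ⟩
    (a , b) ∎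
    where
    open ≡-Reasoning
    first : ∀ a b → - (- b - (a - b)) ≡ a
    first = solve-∀
    second : ∀ a b → - (a - b) - (- b - (a - b)) ≡ b
    second = solve-∀

  [K₂K₁]³≡id : ∀ x → K₂ (K₁ (K₂ (K₁ (K₂ (K₁ x))))) ≡ x
  [K₂K₁]³≡id x = begin
    K₂ (K₁ (K₂ (K₁ (K₂ (K₁ x)))))          ≡⟨ cong (λ y → K₂ (K₁ (K₂ (K₁ (K₂ (K₁ y)))))) (K₂-involutive x) ⟨
    K₂ (K₁ (K₂ (K₁ (K₂ (K₁ (K₂ (K₂ x))))))) ≡⟨ cong K₂ ([K₁K₂]³≡id (K₂ x)) ⟩
    K₂ (K₂ x)                              ≡⟨ K₂-involutive x ⟩
    x ∎
    where open ≡-Reasoning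

  orbit-induction : (P : Point → Set) → (∀ {z} → P z → P (K₁ z)) → (∀ {z} → P z → P (K₂ z)) →
                    ∀ {x} → P x → All P (orbit x)
  orbit-induction P k₁ k₂ p =
    p ∷ k₁ p ∷ k₂ (k₁ p) ∷ k₁ (k₂ (k₁ p)) ∷ k₂ (k₁ (k₂ (k₁ p))) ∷ k₁ (k₂ (k₁ (k₂ (k₁ p)))) ∷
    k₂ p ∷ k₁ (k₂ p) ∷ k₂ (k₁ (k₂ p)) ∷ k₁ (k₂ (k₁ (k₂ p))) ∷ k₂ (k₁ (k₂ (k₁ (k₂ p)))) ∷ []

  pattern at₀ e = here e
  pattern at₁ e = there (at₀ e)
  pattern at₂ e = there (at₁ e)
  pattern at₃ e = there (at₂ e)
  pattern at₄ e = there (at₃ e)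
  pattern at₅ e = there (at₄ e)
  pattern at₆ e = there (at₅ e)
  pattern at₇ e = there (at₆ e)
  pattern at₈ e = there (at₇ e)
  pattern at₉ e = there (at₈ e)
  pattern at₁₀ e = there (at₉ e)

  K₁-∈-orbit : ∀ {x z} → z ∈ orbit x → K₁ z ∈ orbit x
  K₁-∈-orbit (at₀ refl) = at₁ refl
  K₁-∈-orbit (at₁ refl) = at₀ (K₁-involutive _)
  K₁-∈-orbit (at₂ refl) = at₃ refl
  K₁-∈-orbit (at₃ refl) = at₂ (K₁-involutive _)
  K₁-∈-orbit (at₄ refl) = at₅ refl
  K₁-∈-orbit (at₅ refl) = at₄ (K₁-involutive _)
  K₁-∈-orbit (at₆ refl) = at₇ refl
  K₁-∈-orbit (at₇ refl) = at₆ (K₁-involutive _)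
  K₁-∈-orbit (at₈ refl) = at₉ refl
  K₁-∈-orbit (at₉ refl) = at₈ (K₁-involutive _)
  K₁-∈-orbit (at₁₀ refl) = at₀ ([K₁K₂]³≡id _)

  K₂-∈-orbit : ∀ {x z} → z ∈ orbit x → K₂ z ∈ orbit x
  K₂-∈-orbit (at₀ refl) = at₆ refl
  K₂-∈-orbit (at₁ refl) = at₂ refl
  K₂-∈-orbit (at₂ refl) = at₁ (K₂-involutive _)
  K₂-∈-orbit (at₃ refl) = at₄ refl
  K₂-∈-orbit (at₄ refl) = at₃ (K₂-involutive _)
  K₂-∈-orbit (at₅ refl) = at₀ ([K₂K₁]³≡id _)
  K₂-∈-orbit (at₆ refl) = at₀ (K₂-involutive _)
  K₂-∈-orbit (at₇ refl) = at₈ refl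
  K₂-∈-orbit (at₈ refl) = at₇ (K₂-involutive _)
  K₂-∈-orbit (at₉ refl) = at₁₀ refl
  K₂-∈-orbit (at₁₀ refl) = at₉ (K₂-involutive _)

  orbit-⊆ : ∀ {x y} → y ∈ orbit x → All (_∈ orbit x) (orbit y)
  orbit-⊆ {x} = orbit-induction (_∈ orbit x) K₁-∈-orbit K₂-∈-orbit

  ∈-orbit-trans : ∀ {x y z} → y ∈ orbit x → z ∈ orbit y → z ∈ orbit x
  ∈-orbit-trans y∈ z∈ = All.lookup (orbit-⊆ y∈) z∈

  ∈-orbit-sym : ∀ {x y} → y ∈ orbit x → x ∈ orbit y
  ∈-orbit-sym {x} y∈ = All.lookup (orbit-induction (λ z → x ∈ orbit z) stepK₁ stepK₂ (at₀ refl)) y∈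
    where
    stepK₁ : ∀ {z} → x ∈ orbit z → x ∈ orbit (K₁ z)
    stepK₁ {z} = ∈-orbit-trans (at₁ (sym (K₁-involutive z)))
    stepK₂ : ∀ {z} → x ∈ orbit z → x ∈ orbit (K₂ z)
    stepK₂ {z} = ∈-orbit-trans (at₆ (sym (K₂-involutive z)))

  ∈-orbit⇒SameOrbit : ∀ {x y} → y ∈ orbit x → SameOrbit x y
  ∈-orbit⇒SameOrbit y∈ = orbit-⊆ (∈-orbit-sym y∈) , orbit-⊆ y∈

  SameOrbit⇒∈-orbit : ∀ {x y} → SameOrbit x y → y ∈ orbit x
  SameOrbit⇒∈-orbit (_ , orbit-y⊆orbit-x) = All.lookup orbit-y⊆orbit-x (at₀ refl)

  orbitLength-K₁ : ∀ x → orbitLength (K₁ x) ≡ orbitLength x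
  orbitLength-K₁ (a , b) = cong (2 ℕ.*_) (begin
    ∣ + 2 * (- a + b) - b ∣ ℕ.+ ∣ - a + b + b ∣ ℕ.+ ∣ + 2 * b - (- a + b) ∣
      ≡⟨ cong₂ ℕ._+_ (cong₂ ℕ._+_ (trans (cong ∣_∣ (flip a b)) (ℤ.∣-i∣≡∣i∣ (+ 2 * a - b))) (cong ∣_∣ (swap a b)))
                     (cong ∣_∣ (sum a b)) ⟩
    ∣ + 2 * a - b ∣ ℕ.+ ∣ + 2 * b - a ∣ ℕ.+ ∣ a + b ∣
      ≡⟨ +-CS.xy∙z≈xz∙y (∣ + 2 * a - b ∣) (∣ + 2 * b - a ∣) (∣ a + b ∣) ⟩
    ∣ + 2 * a - b ∣ ℕ.+ ∣ a + b ∣ ℕ.+ ∣ + 2 * b - a ∣ ∎)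
    where
    open ≡-Reasoning
    flip : ∀ a b → + 2 * (- a + b) - b ≡ - (+ 2 * a - b)
    flip = solve-∀
    swap : ∀ a b → - a + b + b ≡ + 2 * b - a
    swap = solve-∀
    sum : ∀ a b → + 2 * b - (- a + b) ≡ a + b
    sum = solve-∀

  orbitLength-K₂ : ∀ x → orbitLength (K₂ x) ≡ orbitLength x
  orbitLength-K₂ (a , b) = cong (2 ℕ.*_) (begin
    ∣ + 2 * a - (a - b) ∣ ℕ.+ ∣ a + (a - b) ∣ ℕ.+ ∣ + 2 * (a - b) - a ∣
      ≡⟨ cong₂ ℕ._+_ (cong₂ ℕ._+_ (cong ∣_∣ (sum a b)) (cong ∣_∣ (swap a b)))
                     (trans (cong ∣_∣ (flip a b)) (ℤ.∣-i∣≡∣i∣ (+ 2 * b - a))) ⟩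
    ∣ a + b ∣ ℕ.+ ∣ + 2 * a - b ∣ ℕ.+ ∣ + 2 * b - a ∣
      ≡⟨ cong (ℕ._+ ∣ + 2 * b - a ∣) (ℕ.+-comm (∣ a + b ∣) (∣ + 2 * a - b ∣)) ⟩
    ∣ + 2 * a - b ∣ ℕ.+ ∣ a + b ∣ ℕ.+ ∣ + 2 * b - a ∣ ∎)
    where
    open ≡-Reasoning
    sum : ∀ a b → + 2 * a - (a - b) ≡ a + b
    sum = solve-∀
    swap : ∀ a b → a + (a - b) ≡ + 2 * a - b
    swap = solve-∀
    flip : ∀ a b → + 2 * (a - b) - a ≡ - (+ 2 * b - a)
    flip = solve-∀

  orbitLength-invariant : ∀ {x y} → y ∈ orbit x → orbitLength y ≡ orbitLength x
  orbitLength-invariant {x} = All.lookup (orbit-induction (λ y → orbitLength y ≡ orbitLength x)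
    (λ {z} e → trans (orbitLength-K₁ z) e) (λ {z} e → trans (orbitLength-K₂ z) e) refl)

  orbitLength-swap : ∀ a b → orbitLength (a , b) ≡ orbitLength (b , a)
  orbitLength-swap a b = cong (2 ℕ.*_) (trans
    (cong (λ s → ∣ + 2 * a - b ∣ ℕ.+ ∣ s ∣ ℕ.+ ∣ + 2 * b - a ∣) (ℤ.+-comm a b))
    (+-CS.xy∙z≈zy∙x (∣ + 2 * a - b ∣) (∣ b + a ∣) (∣ + 2 * b - a ∣)))

module Hexagon where

  open Orbit using (orbit-induction; at₀; at₁; at₂; at₃; at₄; at₅)
  open import Data.Integer using (-_; _-_)
  import Data.Integer.Properties as ℤ
  open import Data.Integer.Tactic.RingSolver using (solve)
  open import Data.Product using (_,_)
  open import Data.List using (List; []; _∷_)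
  open import Data.List.Relation.Unary.All as All using ()
  open import Data.List.Membership.Propositional using (_∈_)
  open import Relation.Binary.PropositionalEquality

  hexagon : Point → List Point
  hexagon (a , b) = (a , b) ∷ (b - a , b) ∷ (b - a , - a) ∷ (- b , - a) ∷ (- b , a - b) ∷ (a , a - b) ∷ []

  K₁-∈-hexagon : ∀ {x z} → z ∈ hexagon x → K₁ z ∈ hexagon x
  K₁-∈-hexagon {a , b} (at₀ refl) = at₁ (cong (_, b) (ℤ.+-comm (- a) b))
  K₁-∈-hexagon {a , b} (at₁ refl) = at₀ (cong (_, b) (solve (a ∷ b ∷ [])))
  K₁-∈-hexagon {a , b} (at₂ refl) = at₃ (cong (_, - a) (solve (a ∷ b ∷ [])))
  K₁-∈-hexagon {a , b} (at₃ refl) = at₂ (cong (_, - a) (solve (a ∷ b ∷ [])))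
  K₁-∈-hexagon {a , b} (at₄ refl) = at₅ (cong (_, a - b) (solve (a ∷ b ∷ [])))
  K₁-∈-hexagon {a , b} (at₅ refl) = at₄ (cong (_, a - b) (solve (a ∷ b ∷ [])))

  K₂-∈-hexagon : ∀ {x z} → z ∈ hexagon x → K₂ z ∈ hexagon x
  K₂-∈-hexagon {a , b} (at₀ refl) = at₅ refl
  K₂-∈-hexagon {a , b} (at₁ refl) = at₂ (cong (b - a ,_) (solve (a ∷ b ∷ [])))
  K₂-∈-hexagon {a , b} (at₂ refl) = at₁ (cong (b - a ,_) (solve (a ∷ b ∷ [])))
  K₂-∈-hexagon {a , b} (at₃ refl) = at₄ (cong (- b ,_) (solve (a ∷ b ∷ [])))
  K₂-∈-hexagon {a , b} (at₄ refl) = at₃ (cong (- b ,_) (solve (a ∷ b ∷ [])))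
  K₂-∈-hexagon {a , b} (at₅ refl) = at₀ (cong (a ,_) (solve (a ∷ b ∷ [])))

  orbit⊆hexagon : ∀ {x y} → y ∈ orbit x → y ∈ hexagon x
  orbit⊆hexagon {x} = All.lookup (orbit-induction (_∈ hexagon x) K₁-∈-hexagon K₂-∈-hexagon (at₀ refl))

module Representatives where

  open Orbit
  open Hexagon
  open import Data.Nat as ℕ using (ℕ; zero; suc; z≤n; s≤s; _≤_; _<_; _∸_)
  import Data.Nat.Properties as ℕ
  open import Data.Nat.Divisibility using (_∣_; divides)
  open import Data.Nat.Tactic.RingSolver using () renaming (solve-∀ to ℕ-solve-∀)
  open import Data.Integer as ℤ using (+_; -[1+_]; -_; _+_; _-_; _*_; ∣_∣)
  import Data.Integer.Properties as ℤ
  open import Data.Integer.Tactic.RingSolver using (solve-∀)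
  open import Data.Product using (_×_; _,_; proj₁; proj₂; ∃; ∃₂)
  open import Data.Sum using (_⊎_; inj₁; inj₂)
  open import Data.Empty using (⊥; ⊥-elim)
  open import Data.List.Membership.Propositional using (_∈_)
  open import Relation.Nullary using (Dec; yes; no; ¬_)
  open import Relation.Nullary.Decidable using (_×-dec_; _⊎-dec_)
  open import Relation.Unary using (Decidable)
  open import Relation.Binary using (tri<; tri≈; tri>)
  open import Relation.Binary.PropositionalEquality

  data QuadrantVertex : ℕ → ℕ → ℕ → ℕ → Set where
    self    : ∀ {a b} → QuadrantVertex a b a b
    shift₁  : ∀ {a c} → QuadrantVertex a (c ℕ.+ a) c (c ℕ.+ a)
    shift₂  : ∀ {b e} → QuadrantVertex (e ℕ.+ b) b (e ℕ.+ b) e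
    corner₁ : ∀ {b} → QuadrantVertex 0 b b 0
    corner₂ : ∀ {a} → QuadrantVertex a 0 0 a

  +c≡+b-+a⇒c+a≡b : ∀ {a b c} → + c ≡ + b - + a → c ℕ.+ a ≡ b
  +c≡+b-+a⇒c+a≡b {a} {b} {c} eq = ℤ.+-injective (begin
    + (c ℕ.+ a)     ≡⟨ ℤ.pos-+ c a ⟩
    + c + + a       ≡⟨ cong (_+ + a) eq ⟩
    + b - + a + + a ≡⟨ cancel (+ a) (+ b) ⟩
    + b             ∎)
    where
    open ≡-Reasoning
    cancel : ∀ a b → b - a + a ≡ b
    cancel = solve-∀

  +c≡-+a⇒c≡0×a≡0 : ∀ {a c} → + c ≡ - + a → c ≡ 0 × a ≡ 0
  +c≡-+a⇒c≡0×a≡0 {zero}  {zero} refl = refl , refl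
  +c≡-+a⇒c≡0×a≡0 {suc a} {c}    ()

  hexagon-quadrant : ∀ {a b c e} → (+ c , + e) ∈ hexagon (+ a , + b) → QuadrantVertex a b c e
  hexagon-quadrant (at₀ eq) with ℤ.+-injective (cong proj₁ eq) | ℤ.+-injective (cong proj₂ eq)
  ... | refl | refl = self
  hexagon-quadrant {a} {b} (at₁ eq)
    with +c≡+b-+a⇒c+a≡b {a} {b} (cong proj₁ eq) | ℤ.+-injective (cong proj₂ eq)
  ... | refl | refl = shift₁
  hexagon-quadrant {a} {b} {c} (at₂ eq) with +c≡-+a⇒c≡0×a≡0 {a} (cong proj₂ eq)
  ... | refl , refl with trans (sym (ℕ.+-identityʳ c)) (+c≡+b-+a⇒c+a≡b {0} {b} (cong proj₁ eq))
  ...   | refl = corner₁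
  hexagon-quadrant {a} {b} (at₃ eq)
    with +c≡-+a⇒c≡0×a≡0 {b} (cong proj₁ eq) | +c≡-+a⇒c≡0×a≡0 {a} (cong proj₂ eq)
  ... | refl , refl | refl , refl = self
  hexagon-quadrant {a} {b} {c} {e} (at₄ eq) with +c≡-+a⇒c≡0×a≡0 {b} (cong proj₁ eq)
  ... | refl , refl with trans (sym (ℕ.+-identityʳ e)) (+c≡+b-+a⇒c+a≡b {0} {a} (cong proj₂ eq))
  ...   | refl = corner₂
  hexagon-quadrant {a} {b} (at₅ eq)
    with ℤ.+-injective (cong proj₁ eq) | +c≡+b-+a⇒c+a≡b {b} {a} (cong proj₂ eq)
  ... | refl | refl = shift₂

  Low : ℕ → ℕ → Set
  Low i j = 1 ≤ j × j ℕ.+ j ≤ i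

  low? : ∀ i j → Dec (Low i j)
  low? i j = 1 ℕ.≤? j ×-dec j ℕ.+ j ℕ.≤? i

  Low⇒> : ∀ {i j} → Low i j → j < i
  Low⇒> {i} {j} (1≤j , j+j≤i) = ℕ.<-≤-trans (ℕ.m<m+n j 1≤j) j+j≤i

  Representative : ℕ → ℕ → Set
  Representative i j = i ≡ j ⊎ Low j i ⊎ Low i j

  representative? : ∀ i j → Dec (Representative i j)
  representative? i j = i ℕ.≟ j ⊎-dec low? j i ⊎-dec low? i j

  Representative-swap : ∀ {i j} → Representative i j → Representative j i
  Representative-swap (inj₁ i≡j)        = inj₁ (sym i≡j)
  Representative-swap (inj₂ (inj₁ low)) = inj₂ (inj₂ low)
  Representative-swap (inj₂ (inj₂ low)) = inj₂ (inj₁ low)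

  Representative-0 : ∀ {b} → Representative 0 b → b ≡ 0
  Representative-0 (inj₁ 0≡b)               = sym 0≡b
  Representative-0 (inj₂ (inj₁ (() , _)))
  Representative-0 (inj₂ (inj₂ low)) with Low⇒> low
  ... | ()

  Representative-shift : ∀ {a c} → Representative a (c ℕ.+ a) → Representative c (c ℕ.+ a) → a ≡ c
  Representative-shift {a} {c} (inj₁ a≡c+a) rep-c with ℕ.+-cancelʳ-≡ a c 0 (sym a≡c+a)
  ... | refl = Representative-0 rep-c
  Representative-shift {a} {c} (inj₂ (inj₁ (1≤a , _))) (inj₁ c≡c+a)
    with ℕ.+-cancelˡ-≡ c a 0 (trans (sym c≡c+a) (sym (ℕ.+-identityʳ c)))
  ... | refl with 1≤a
  ...   | ()
  Representative-shift {a} {c} (inj₂ (inj₁ (_ , a+a≤c+a))) (inj₂ (inj₁ (_ , c+c≤c+a))) =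
    ℕ.≤-antisym (ℕ.+-cancelʳ-≤ a a c a+a≤c+a) (ℕ.+-cancelˡ-≤ c c a c+c≤c+a)
  Representative-shift {a} {c} (inj₂ (inj₁ _)) (inj₂ (inj₂ low)) = ⊥-elim (ℕ.<⇒≱ (Low⇒> low) (ℕ.m≤m+n c a))
  Representative-shift {a} {c} (inj₂ (inj₂ low)) _ = ⊥-elim (ℕ.<⇒≱ (Low⇒> low) (ℕ.m≤n+m a c))

  Representative-unique : ∀ {a b c e} → Representative a b → Representative c e →
                          QuadrantVertex a b c e → a ≡ c × b ≡ e
  Representative-unique _     _     self    = refl , refl
  Representative-unique rep-a rep-c shift₁  = Representative-shift rep-a rep-c , refl
  Representative-unique rep-b rep-e shift₂  =
    refl , Representative-shift (Representative-swap rep-b) (Representative-swap rep-e)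
  Representative-unique rep-0 _     corner₁ with Representative-0 rep-0
  ... | refl = refl , refl
  Representative-unique rep-0 _     corner₂ with Representative-0 (Representative-swap rep-0)
  ... | refl = refl , refl

  IsRepresentative : Point → Set
  IsRepresentative (+ i , + j)        = Representative i j
  IsRepresentative (+ _ , -[1+ _ ])   = ⊥
  IsRepresentative (-[1+ _ ] , _)     = ⊥

  isRepresentative? : Decidable IsRepresentative
  isRepresentative? (+ i , + j)      = representative? i j
  isRepresentative? (+ _ , -[1+ _ ]) = no λ ()
  isRepresentative? (-[1+ _ ] , _)   = no λ ()

  representatives-separated : ∀ {u v} → IsRepresentative u → IsRepresentative v → v ∈ orbit u → u ≡ v
  representatives-separated {+ _ , + _} {+ _ , + _} rep-u rep-v v∈
    with Representative-unique rep-u rep-v (hexagon-quadrant (orbit⊆hexagon v∈))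
  ... | refl , refl = refl
  representatives-separated {+ _ , + _}      {+ _ , -[1+ _ ]} _ () _
  representatives-separated {+ _ , + _}      { -[1+ _ ] , _ } _ () _
  representatives-separated {+ _ , -[1+ _ ]} {_}              () _ _
  representatives-separated { -[1+ _ ] , _ } {_}              () _ _

  K₁-pos : ∀ {i j} → i ≤ j → K₁ (+ i , + j) ≡ (+ (j ∸ i) , + j)
  K₁-pos {i} {j} i≤j = cong (_, + j) (trans (ℤ.+-comm (- + i) (+ j)) (trans (ℤ.m-n≡m⊖n j i) (ℤ.⊖-≥ i≤j)))

  K₂-pos : ∀ {i j} → j ≤ i → K₂ (+ i , + j) ≡ (+ i , + (i ∸ j))
  K₂-pos {i} {j} j≤i = cong (+ i ,_) (trans (ℤ.m-n≡m⊖n i j) (ℤ.⊖-≥ j≤i))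

  ∸-representative : ∀ {i j} → i < j → ¬ Low j i → Representative (j ∸ i) j
  ∸-representative {zero}  _   _    = inj₁ refl
  ∸-representative {suc i} {j} i<j ¬low = inj₂ (inj₁ (ℕ.m<n⇒0<n∸m i<j , (begin
    (j ∸ suc i) ℕ.+ (j ∸ suc i) ≤⟨ ℕ.+-monoʳ-≤ (j ∸ suc i) (ℕ.m≤n+o⇒m∸n≤o j (suc i) j≤2i) ⟩
    (j ∸ suc i) ℕ.+ suc i       ≡⟨ ℕ.m∸n+n≡m (ℕ.<⇒≤ i<j) ⟩
    j                           ∎)))
    where
    open ℕ.≤-Reasoning
    j≤2i : j ≤ suc i ℕ.+ suc i
    j≤2i = ℕ.<⇒≤ (ℕ.≰⇒> λ 2i≤j → ¬low (s≤s z≤n , 2i≤j))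

  representative-in-orbit : ∀ {M i j} → i ≤ M → j ≤ M → ∃₂ λ i′ j′ →
    i′ ≤ M × j′ ≤ M × Representative i′ j′ × (+ i′ , + j′) ∈ orbit (+ i , + j)
  representative-in-orbit {M} {i} {j} i≤M j≤M with ℕ.<-cmp i j
  ... | tri≈ _ refl _ = i , i , i≤M , i≤M , inj₁ refl , at₀ refl
  ... | tri< i<j _ _ with low? j i
  ...   | yes low = i , j , i≤M , j≤M , inj₂ (inj₁ low) , at₀ refl
  ...   | no ¬low = j ∸ i , j , ℕ.≤-trans (ℕ.m∸n≤m j i) j≤M , j≤M ,
                    ∸-representative i<j ¬low , at₁ (sym (K₁-pos (ℕ.<⇒≤ i<j)))
  representative-in-orbit {M} {i} {j} i≤M j≤M | tri> _ _ j<i with low? i j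
  ...   | yes low = i , j , i≤M , j≤M , inj₂ (inj₂ low) , at₀ refl
  ...   | no ¬low = i , i ∸ j , i≤M , ℕ.≤-trans (ℕ.m∸n≤m i j) i≤M ,
                    Representative-swap (∸-representative j<i ¬low) , at₆ (sym (K₂-pos (ℕ.<⇒≤ j<i)))

  orbitLength-diagonal : ∀ i → orbitLength (+ i , + i) ≡ 4 ℕ.* (2 ℕ.* i)
  orbitLength-diagonal i = begin
    2 ℕ.* (∣ + 2 * + i - + i ∣ ℕ.+ (i ℕ.+ i) ℕ.+ ∣ + 2 * + i - + i ∣)
      ≡⟨ cong (λ p → 2 ℕ.* (p ℕ.+ (i ℕ.+ i) ℕ.+ p)) (cong ∣_∣ (twice-minus (+ i))) ⟩
    2 ℕ.* (i ℕ.+ (i ℕ.+ i) ℕ.+ i)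
      ≡⟨ rearrange i ⟩
    4 ℕ.* (2 ℕ.* i) ∎
    where
    open ≡-Reasoning
    twice-minus : ∀ a → + 2 * a - a ≡ a
    twice-minus = solve-∀
    rearrange : ∀ i → 2 ℕ.* (i ℕ.+ (i ℕ.+ i) ℕ.+ i) ≡ 4 ℕ.* (2 ℕ.* i)
    rearrange = ℕ-solve-∀

  orbitLength-low : ∀ j t → orbitLength (+ (j ℕ.+ j ℕ.+ t) , + j) ≡ 4 ℕ.* (3 ℕ.* j ℕ.+ 2 ℕ.* t)
  orbitLength-low j t = begin
    2 ℕ.* (∣ + 2 * (+ j + + j + + t) - + j ∣ ℕ.+ ∣ + j + + j + + t + + j ∣ ℕ.+ ∣ + 2 * + j - (+ j + + j + + t) ∣)
      ≡⟨ cong₂ (λ p q → 2 ℕ.* (p ℕ.+ ∣ + j + + j + + t + + j ∣ ℕ.+ q))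
               (cong ∣_∣ (first-term (+ j) (+ t))) (trans (cong ∣_∣ (third-term (+ j) (+ t))) (ℤ.∣-i∣≡∣i∣ (+ t))) ⟩
    2 ℕ.* ((j ℕ.+ j ℕ.+ j ℕ.+ t ℕ.+ t) ℕ.+ (j ℕ.+ j ℕ.+ t ℕ.+ j) ℕ.+ t)
      ≡⟨ rearrange j t ⟩
    4 ℕ.* (3 ℕ.* j ℕ.+ 2 ℕ.* t) ∎
    where
    open ≡-Reasoning
    first-term : ∀ a b → + 2 * (a + a + b) - a ≡ a + a + a + b + b
    first-term = solve-∀
    third-term : ∀ a b → + 2 * a - (a + a + b) ≡ - b
    third-term = solve-∀
    rearrange : ∀ j t →
      2 ℕ.* ((j ℕ.+ j ℕ.+ j ℕ.+ t ℕ.+ t) ℕ.+ (j ℕ.+ j ℕ.+ t ℕ.+ j) ℕ.+ t) ≡ 4 ℕ.* (3 ℕ.* j ℕ.+ 2 ℕ.* t)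
    rearrange = ℕ-solve-∀

  Low⇒orbitLength : ∀ {i j} → Low i j →
                    ∃ λ t → i ≡ j ℕ.+ j ℕ.+ t × orbitLength (+ i , + j) ≡ 4 ℕ.* (3 ℕ.* j ℕ.+ 2 ℕ.* t)
  Low⇒orbitLength {j = j} (_ , j+j≤i) with ℕ.m≤n⇒∃[o]m+o≡n j+j≤i
  ... | t , refl = t , refl , orbitLength-low j t

  Representative⇒4∣orbitLength : ∀ {i j} → Representative i j → 4 ∣ orbitLength (+ i , + j)
  Representative⇒4∣orbitLength {i} (inj₁ refl) =
    divides (2 ℕ.* i) (trans (orbitLength-diagonal i) (ℕ.*-comm 4 (2 ℕ.* i)))
  Representative⇒4∣orbitLength {i} {j} (inj₂ (inj₁ low)) with Low⇒orbitLength low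
  ... | t , refl , length≡ = divides (3 ℕ.* i ℕ.+ 2 ℕ.* t)
    (trans (orbitLength-swap (+ i) (+ j)) (trans length≡ (ℕ.*-comm 4 (3 ℕ.* i ℕ.+ 2 ℕ.* t))))
  Representative⇒4∣orbitLength {j = j} (inj₂ (inj₂ low)) with Low⇒orbitLength low
  ... | t , refl , length≡ = divides (3 ℕ.* j ℕ.+ 2 ℕ.* t) (trans length≡ (ℕ.*-comm 4 (3 ℕ.* j ℕ.+ 2 ℕ.* t)))

module Box where

  open Sums
  open import Data.Nat as ℕ using (ℕ; zero; suc; _≤_; s≤s)
  open import Data.Nat.Properties using (m<1+n⇒m≤n)
  open import Data.Integer using (+_)
  open import Data.Product using (_×_; _,_; ∃₂)
  open import Data.List
    using (List; []; _∷_; _++_; map; concatMap; cartesianProductWith; applyUpTo; upTo; filter; length)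
  open import Data.List.Properties using (length-++; filter-++)
  open import Data.List.Membership.Propositional using (_∈_)
  open import Data.List.Membership.Propositional.Properties
    using (∈-cartesianProductWith⁺; ∈-cartesianProductWith⁻; ∈-upTo⁺; ∈-upTo⁻)
  open import Data.List.Relation.Unary.Unique.Propositional using (Unique)
  import Data.List.Relation.Unary.Unique.Propositional.Properties as Unique
  open import Relation.Nullary using (yes; no)
  open import Relation.Unary using (Decidable)
  open import Relation.Binary.PropositionalEquality

  concatMap≡cartesianProductWith : ∀ {A B C : Set} (f : A → B → C) xs ys →
    concatMap (λ x → map (f x) ys) xs ≡ cartesianProductWith f xs ys
  concatMap≡cartesianProductWith f []       ys = refl
  concatMap≡cartesianProductWith f (x ∷ xs) ys = cong (map (f x) ys ++_) (concatMap≡cartesianProductWith f xs ys)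

  box≡ : ∀ M → box M ≡ cartesianProductWith (λ i j → (+ i , + j)) (upTo (suc M)) (upTo (suc M))
  box≡ M = concatMap≡cartesianProductWith _ (upTo (suc M)) (upTo (suc M))

  ∈-box⁺ : ∀ {M i j} → i ≤ M → j ≤ M → (+ i , + j) ∈ box M
  ∈-box⁺ {M} {i} {j} i≤M j≤M = subst ((+ i , + j) ∈_) (sym (box≡ M))
                         (∈-cartesianProductWith⁺ _ (∈-upTo⁺ (s≤s i≤M)) (∈-upTo⁺ (s≤s j≤M)))

  ∈-box⁻ : ∀ {M x} → x ∈ box M → ∃₂ λ i j → i ≤ M × j ≤ M × x ≡ (+ i , + j)
  ∈-box⁻ {M} {x} x∈box
    with ∈-cartesianProductWith⁻ _ (upTo (suc M)) (upTo (suc M)) (subst (x ∈_) (box≡ M) x∈box)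
  ... | i , j , i∈ , j∈ , x≡ = i , j , m<1+n⇒m≤n (∈-upTo⁻ i∈) , m<1+n⇒m≤n (∈-upTo⁻ j∈) , x≡

  box-Unique : ∀ M → Unique (box M)
  box-Unique M = subst Unique (sym (box≡ M))
    (Unique.cartesianProductWith⁺ _ injective (Unique.upTo⁺ (suc M)) (Unique.upTo⁺ (suc M)))
    where
    injective : ∀ {i i′ j j′} → (+ i , + j) ≡ (+ i′ , + j′) → i ≡ i′ × j ≡ j′
    injective refl = refl , refl

  module _ {A : Set} {P : A → Set} (P? : Decidable P) where

    count : List A → ℕ
    count xs = length (filter P? xs)

    count-∷ : ∀ x xs → count (x ∷ xs) ≡ 𝟙[ P? x ] ℕ.+ count xs
    count-∷ x xs with P? x
    ... | yes _ = refl
    ... | no _  = refl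

    count-++ : ∀ xs ys → count (xs ++ ys) ≡ count xs ℕ.+ count ys
    count-++ xs ys = trans (cong length (filter-++ P? xs ys)) (length-++ (filter P? xs))

    count-map-applyUpTo : ∀ (h : ℕ → A) g n → count (map h (applyUpTo g n)) ≡ ∑[ k < n ] 𝟙[ P? (h (g k)) ]
    count-map-applyUpTo h g zero    = refl
    count-map-applyUpTo h g (suc n) =
      trans (count-∷ (h (g 0)) _) (cong (𝟙[ P? (h (g 0)) ] ℕ.+_) (count-map-applyUpTo h (λ k → g (suc k)) n))

    count-cartesianProductWith : ∀ {B : Set} (f : ℕ → B → A) g n ys →
      count (cartesianProductWith f (applyUpTo g n) ys) ≡ ∑[ i < n ] count (map (f (g i)) ys)
    count-cartesianProductWith f g zero    ys = refl
    count-cartesianProductWith f g (suc n) ys =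
      trans (count-++ (map (f (g 0)) ys) _)
            (cong (count (map (f (g 0)) ys) ℕ.+_) (count-cartesianProductWith f (λ k → g (suc k)) n ys))

  count-box : ∀ {P : Point → Set} (P? : Decidable P) M →
    count P? (box M) ≡ ∑[ i < suc M ] ∑[ j < suc M ] 𝟙[ P? (+ i , + j) ]
  count-box P? M = begin
    count P? (box M) ≡⟨ cong (count P?) (box≡ M) ⟩
    count P? (cartesianProductWith (λ i j → (+ i , + j)) (upTo (suc M)) (upTo (suc M)))
      ≡⟨ count-cartesianProductWith P? (λ i j → (+ i , + j)) (λ i → i) (suc M) (upTo (suc M)) ⟩
    ∑[ i < suc M ] count P? (map (λ j → (+ i , + j)) (upTo (suc M)))
      ≡⟨ ∑-cong (suc M) (λ {i} _ → count-map-applyUpTo P? (λ j → (+ i , + j)) (λ j → j) (suc M)) ⟩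
    ∑[ i < suc M ] ∑[ j < suc M ] 𝟙[ P? (+ i , + j) ] ∎
    where open ≡-Reasoning

module OrbitCount where

  open Orbit
  open Representatives
    using (IsRepresentative; isRepresentative?; representatives-separated; representative-in-orbit)
  open Box using (∈-box⁺; ∈-box⁻)
  open import Level using (0ℓ)
  open import Relation.Binary.Bundles using (DecSetoid)
  open import Data.Nat.Properties using (≤-antisym)
  open import Data.Integer using (+_)
  open import Data.Product using (_×_; _,_; proj₁; ∃)
  open import Function using (id)
  open import Data.List using (List; []; _∷_; filter; deduplicate; length)
  open import Data.List.Relation.Unary.All as All using (All; []; _∷_)
  open import Data.List.Relation.Unary.All.Properties using (all-filter)
  open import Data.List.Membership.Propositional using (_∈_; lose; find)
  open import Data.List.Membership.Propositional.Properties using (∈-filter⁺; ∈-filter⁻; ∈-deduplicate⁻)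
  open import Data.List.Membership.Setoid.Properties using (∈-deduplicate⁺)
  open import Data.List.Relation.Unary.AllPairs using ([]; _∷_)
  import Data.List.Relation.Unary.Unique.Propositional as ≡
  import Data.List.Relation.Unary.Unique.Propositional.Properties as ≡
  open import Data.List.Relation.Unary.Unique.DecSetoid.Properties using (deduplicate-!)
  import Data.List.Relation.Unary.Unique.Setoid.Properties as Unique
  open import Relation.Nullary.Decidable using (_×-dec_)
  open import Relation.Unary using (Decidable)
  open import Relation.Nullary using (¬_)
  open import Relation.Binary.PropositionalEquality using (_≡_; _≢_; refl)

  SameOrbit-refl : ∀ {x} → SameOrbit x x
  SameOrbit-refl = All.tabulate id , All.tabulate id

  SameOrbit-sym : ∀ {x y} → SameOrbit x y → SameOrbit y x
  SameOrbit-sym (x⊆y , y⊆x) = y⊆x , x⊆y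

  SameOrbit-trans : ∀ {x y z} → SameOrbit x y → SameOrbit y z → SameOrbit x z
  SameOrbit-trans (x⊆y , y⊆x) (y⊆z , z⊆y) = All.map (All.lookup y⊆z) x⊆y , All.map (All.lookup y⊆x) z⊆y

  orbitDecSetoid : DecSetoid 0ℓ 0ℓ
  orbitDecSetoid = record
    { Carrier          = Point
    ; _≈_              = SameOrbit
    ; isDecEquivalence = record
      { isEquivalence = record { refl = SameOrbit-refl ; sym = SameOrbit-sym ; trans = SameOrbit-trans }
      ; _≟_           = sameOrbit?
      }
    }

  open DecSetoid orbitDecSetoid using (setoid)
  open import Data.List.Membership.Setoid setoid as SameOrbit using ()
  open import Data.List.Relation.Unary.Unique.Setoid setoid using (Unique)
  open UniqueLists setoid using (Unique-⊆⇒length≤)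

  representatives-Unique : ∀ {xs} → ≡.Unique xs → All IsRepresentative xs → Unique xs
  representatives-Unique []          []          = []
  representatives-Unique {x ∷ _} (x≢ ∷ xs!) (rep-x ∷ reps) =
    All.zipWith separated (x≢ , reps) ∷ representatives-Unique xs! reps
    where
    separated : ∀ {y} → x ≢ y × IsRepresentative y → ¬ SameOrbit x y
    separated (x≢y , rep-y) x~y = x≢y (representatives-separated rep-x rep-y (SameOrbit⇒∈-orbit x~y))

  box-covered : ∀ {M x} → x ∈ box M → ∃ λ z → z ∈ box M × IsRepresentative z × z ∈ orbit x
  box-covered {M} x∈box with ∈-box⁻ {M} x∈box
  ... | i , j , i≤M , j≤M , refl with representative-in-orbit i≤M j≤M
  ...   | i′ , j′ , i′≤M , j′≤M , rep , z∈orbit = (+ i′ , + j′) , ∈-box⁺ {M} i′≤M j′≤M , rep , z∈orbit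

  module _ {P : Point → Set} (P? : Decidable P) (P-invariant : ∀ {x y} → SameOrbit x y → P x → P y)
           {xs : List Point} (xs! : ≡.Unique xs)
           (covered : ∀ {x} → x ∈ xs → ∃ λ z → z ∈ xs × IsRepresentative z × z ∈ orbit x) where

    representative∧P? : Decidable (λ x → IsRepresentative x × P x)
    representative∧P? x = isRepresentative? x ×-dec P? x

    private
      orbits reps : List Point
      orbits = filter P? (deduplicate sameOrbit? xs)
      reps   = filter representative∧P? xs

      orbits! : Unique orbits
      orbits! = Unique.filter⁺ setoid P? (deduplicate-! orbitDecSetoid xs)

      reps! : Unique reps
      reps! = representatives-Unique (≡.filter⁺ representative∧P? xs!)
                                     (All.map proj₁ (all-filter representative∧P? xs))

      orbits⊆reps : ∀ {y} → y SameOrbit.∈ orbits → y SameOrbit.∈ reps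
      orbits⊆reps y∈orbits =
        let w , w∈orbits , y~w      = find y∈orbits
            w∈dedup , P-w           = ∈-filter⁻ P? {xs = deduplicate sameOrbit? xs} w∈orbits
            z , z∈xs , rep , z∈orbit = covered (∈-deduplicate⁻ sameOrbit? xs w∈dedup)
            w~z                     = ∈-orbit⇒SameOrbit z∈orbit
        in  lose (∈-filter⁺ representative∧P? z∈xs (rep , P-invariant w~z P-w)) (SameOrbit-trans y~w w~z)

      reps⊆orbits : ∀ {z} → z SameOrbit.∈ reps → z SameOrbit.∈ orbits
      reps⊆orbits z∈reps =
        let w , w∈reps , z~w   = find z∈reps
            w∈xs , _ , P-w     = ∈-filter⁻ representative∧P? {xs = xs} w∈reps
            v , v∈dedup , w~v  = find (∈-deduplicate⁺ setoid sameOrbit? resp (lose w∈xs SameOrbit-refl))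
        in  lose (∈-filter⁺ P? v∈dedup (P-invariant w~v P-w)) (SameOrbit-trans z~w w~v)
        where
        resp : ∀ {x y z} → SameOrbit z y → SameOrbit x y → SameOrbit x z
        resp z~y x~y = SameOrbit-trans x~y (SameOrbit-sym z~y)

    distinct-orbits≡representatives :
      length (filter P? (deduplicate sameOrbit? xs)) ≡ length (filter representative∧P? xs)
    distinct-orbits≡representatives =
      ≤-antisym (Unique-⊆⇒length≤ orbits! orbits⊆reps) (Unique-⊆⇒length≤ reps! reps⊆orbits)

module Census (d r : ℕ) .{{_ : NonZero d}} where

  open Orbit using (orbitLength-invariant; SameOrbit⇒∈-orbit; orbitLength-swap)
  open Representatives
  open OrbitCount using (distinct-orbits≡representatives; box-covered)
  open Box using (box-Unique; count-box)
  open Sums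
  open import Data.Nat
  open import Data.Nat.Properties
  open import Data.Nat.Divisibility using (_∣_; ∣-trans; %-presˡ-∣)
  open import Data.Nat.Tactic.RingSolver using (solve-∀)
  open import Data.Integer using (+_)
  open import Data.Product using (_×_; _,_)
  open import Data.Sum using (_⊎_; inj₁; inj₂)
  open import Relation.Nullary using (Dec; ¬_)
  open import Relation.Nullary.Decidable using (_×-dec_; _⊎-dec_)
  open import Relation.Unary using (Decidable)
  open import Relation.Binary.PropositionalEquality

  L : ℕ → ℕ → ℕ
  L i j = orbitLength (+ i , + j)

  N≡∑∑ : ∀ M → N r d M ≡ ∑[ i < suc M ] ∑[ j < suc M ] 𝟙[ representative? i j ×-dec L i j % d ≟ r ]
  N≡∑∑ M = trans (distinct-orbits≡representatives hit? hit-invariant (box-Unique M) (box-covered {M}))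
                 (count-box (λ x → isRepresentative? x ×-dec hit? x) M)
    where
    hit? : Decidable (λ x → orbitLength x % d ≡ r)
    hit? x = orbitLength x % d ≟ r
    hit-invariant : ∀ {x y} → SameOrbit x y → orbitLength x % d ≡ r → orbitLength y % d ≡ r
    hit-invariant x~y = trans (cong (_% d) (orbitLength-invariant (SameOrbit⇒∈-orbit x~y)))

  N≡0 : ∀ {g} → g ∣ 4 → g ∣ d → ¬ g ∣ r → ∀ M → N r d M ≡ 0
  N≡0 {g} g∣4 g∣d g∤r M = trans (N≡∑∑ M) (∑-zero (suc M) λ {i} _ → ∑-zero (suc M) λ {j} _ →
    𝟙-≡0 (representative? i j ×-dec L i j % d ≟ r) λ (rep , hit) →
      g∤r (subst (g ∣_) hit (%-presˡ-∣ (∣-trans g∣4 (Representative⇒4∣orbitLength rep)) g∣d)))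

  hit? : ∀ i j → Dec (L i j % d ≡ r)
  hit? i j = L i j % d ≟ r

  diagonal-hit upper-hit lower-hit : ℕ → ℕ → ℕ
  diagonal-hit i j = 𝟙[ i ≟ j ]    * 𝟙[ hit? i j ]
  upper-hit    i j = 𝟙[ low? j i ] * 𝟙[ hit? i j ]
  lower-hit    i j = 𝟙[ low? i j ] * 𝟙[ hit? i j ]

  Diagonal Upper Lower : ℕ → ℕ
  Diagonal M = ∑[ i < suc M ] ∑[ j < suc M ] diagonal-hit i j
  Upper    M = ∑[ i < suc M ] ∑[ j < suc M ] upper-hit i j
  Lower    M = ∑[ i < suc M ] ∑[ j < suc M ] lower-hit i j

  𝟙-representative : ∀ i j → 𝟙[ representative? i j ×-dec hit? i j ] ≡ diagonal-hit i j + upper-hit i j + lower-hit i j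
  𝟙-representative i j = begin
    𝟙[ representative? i j ×-dec hit? i j ]                         ≡⟨ 𝟙-× (representative? i j) (hit? i j) ⟩
    𝟙[ i ≟ j ⊎-dec low? j i ⊎-dec low? i j ] * 𝟙[ hit? i j ]        ≡⟨ cong (λ x → x * 𝟙[ hit? i j ]) disjoint ⟩
    (𝟙[ i ≟ j ] + (𝟙[ low? j i ] + 𝟙[ low? i j ])) * 𝟙[ hit? i j ] ≡⟨ distrib 𝟙[ i ≟ j ] 𝟙[ low? j i ] 𝟙[ low? i j ] _ ⟩
    diagonal-hit i j + upper-hit i j + lower-hit i j                ∎
    where
    open ≡-Reasoning
    distrib : ∀ a b c h → (a + (b + c)) * h ≡ a * h + b * h + c * h
    distrib = solve-∀
    upper-lower : Low j i → ¬ Low i j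
    upper-lower low-ji low-ij = <-asym (Low⇒> low-ji) (Low⇒> low-ij)
    diagonal-off : i ≡ j → ¬ (Low j i ⊎ Low i j)
    diagonal-off refl (inj₁ low) = <-irrefl refl (Low⇒> low)
    diagonal-off refl (inj₂ low) = <-irrefl refl (Low⇒> low)
    disjoint : 𝟙[ i ≟ j ⊎-dec low? j i ⊎-dec low? i j ] ≡ 𝟙[ i ≟ j ] + (𝟙[ low? j i ] + 𝟙[ low? i j ])
    disjoint = trans (𝟙-⊎ (i ≟ j) (low? j i ⊎-dec low? i j) diagonal-off)
                     (cong (_+_ 𝟙[ i ≟ j ]) (𝟙-⊎ (low? j i) (low? i j) upper-lower))

  N≡Diagonal+Upper+Lower : ∀ M → N r d M ≡ Diagonal M + Upper M + Lower M
  N≡Diagonal+Upper+Lower M = begin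
    N r d M
      ≡⟨ N≡∑∑ M ⟩
    ∑[ i < suc M ] ∑[ j < suc M ] 𝟙[ representative? i j ×-dec hit? i j ]
      ≡⟨ ∑-cong (suc M) (λ {i} _ → ∑-cong (suc M) λ {j} _ → 𝟙-representative i j) ⟩
    ∑[ i < suc M ] ∑[ j < suc M ] (diagonal-hit i j + upper-hit i j + lower-hit i j)
      ≡⟨ ∑²-distrib-+ (suc M) (λ i j → diagonal-hit i j + upper-hit i j) lower-hit ⟩
    ∑[ i < suc M ] ∑[ j < suc M ] (diagonal-hit i j + upper-hit i j) + Lower M
      ≡⟨ cong (_+ Lower M) (∑²-distrib-+ (suc M) diagonal-hit upper-hit) ⟩
    Diagonal M + Upper M + Lower M
      ∎
    where open ≡-Reasoning

  Upper≡Lower : ∀ M → Upper M ≡ Lower M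
  Upper≡Lower M = trans (∑-swap (suc M) (suc M) upper-hit)
    (∑-cong (suc M) λ {i} _ → ∑-cong (suc M) λ {j} _ →
      cong (λ n → 𝟙[ low? i j ] * 𝟙[ n % d ≟ r ]) (orbitLength-swap (+ j) (+ i)))

  Diagonal≤ : ∀ M → Diagonal M ≤ suc M
  Diagonal≤ M = begin
    Diagonal M
      ≤⟨ ∑-mono-≤ (suc M) (λ {i} _ → ∑-mono-≤ (suc M) λ {j} _ → m*𝟙≤m 𝟙[ i ≟ j ] (hit? i j)) ⟩
    ∑[ i < suc M ] ∑[ j < suc M ] 𝟙[ i ≟ j ]
      ≤⟨ ∑-mono-≤ (suc M) (λ {i} _ → ∑-𝟙≤1 (suc M) (i ≟_) λ _ _ i≡j i≡k → trans (sym i≡j) i≡k) ⟩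
    ∑[ i < suc M ] 1
      ≡⟨ trans (∑-const (suc M) 1) (*-identityʳ (suc M)) ⟩
    suc M
      ∎
    where open ≤-Reasoning

  N≡Diagonal+2Lower : ∀ M → N r d M ≡ Diagonal M + Lower M + Lower M
  N≡Diagonal+2Lower M = trans (N≡Diagonal+Upper+Lower M) (cong (λ u → Diagonal M + u + Lower M) (Upper≡Lower M))

module LowCount (d r : ℕ) .{{_ : NonZero d}} (m w s : ℕ) .{{_ : NonZero m}} (s<m : s < m)
                (w-cancel : ∀ {δ} → m ∣ w ℕ.* δ → m ∣ δ)
                (reduction : ∀ ℓ → (4 ℕ.* ℓ) ℕ.% d ≡ r ⇔ (w ℕ.* ℓ) ℕ.% m ≡ s) where

  open Representatives using (low?; Low⇒orbitLength; orbitLength-low)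
  open Census d r using (L; hit?; Lower)
  open Sums
  open import Data.Nat
  open import Data.Nat.Properties
  open import Data.Nat.DivMod using ([m+kn]%n≡m%n)
  open import Data.Nat.Divisibility using (_∣_; ∣m+n∣m⇒∣n; m∣m*n)
  open import Data.Nat.Tactic.RingSolver using (solve-∀)
  open import Data.Product using (_,_)
  open import Function using (Equivalence; mk⇔)
  open import Relation.Nullary using (yes; no)
  open import Relation.Binary.PropositionalEquality

  u : ℕ
  u = w * pred m

  u-cancel : ∀ {δ} → m ∣ u * δ → m ∣ δ
  u-cancel {δ} m∣uδ = ∣m+n∣m⇒∣n (subst (m ∣_) m*δ≡ (m∣m*n δ)) (w-cancel (subst (m ∣_) (*-assoc w (pred m) δ) m∣uδ))
    where
    m*δ≡ : m * δ ≡ pred m * δ + δ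
    m*δ≡ = trans (cong (_* δ) (sym (suc-pred m))) (+-comm δ (pred m * δ))

  open ResiduesOfProgressions m u u-cancel using (hits; hits-approx)

  -- The lower representatives in row i are (i , 1 + k) with k < ⌊i/2⌋, of length 4(2i - 1 - k);
  -- as u ≡ - w (mod m), w(2i - 1 - k) ≡ row-offset i + u k (mod m).
  row-offset : ℕ → ℕ
  row-offset i = 2 * w * i + u

  row : ℕ → ℕ → ℕ
  row M i = ∑[ j < suc M ] (𝟙[ low? i j ] * 𝟙[ hit? i j ])

  hit⇔residue : ∀ k t → let i = suc k + suc k + t in
    L i (suc k) % d ≡ r ⇔ (row-offset i + u * k) % m ≡ s
  hit⇔residue k t = mk⇔
    (λ hit → trans residue (Equivalence.to (reduction ℓ) (trans (cong (_% d) (sym length≡)) hit)))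
    (λ hit → trans (cong (_% d) length≡) (Equivalence.from (reduction ℓ) (trans (sym residue) hit)))
    where
    ℓ = 3 * suc k + 2 * t
    length≡ = orbitLength-low (suc k) t
    polynomial : ∀ w p k t →
      2 * w * (suc k + suc k + t) + w * p + w * p * k ≡ w * (3 * suc k + 2 * t) + w * suc k * suc p
    polynomial = solve-∀
    residue : (row-offset (suc k + suc k + t) + u * k) % m ≡ (w * ℓ) % m
    residue = trans (cong (_% m) (trans (polynomial w (pred m) k t) (cong (λ n → w * ℓ + w * suc k * n) (suc-pred m))))
                    ([m+kn]%n≡m%n (w * ℓ) (w * suc k) m)

  row-term : ∀ i k →
    𝟙[ low? i (suc k) ] * 𝟙[ hit? i (suc k) ] ≡ 𝟙[ k <? ⌊ i /2⌋ ] * 𝟙[ (row-offset i + u * k) % m ≟ s ]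
  row-term i k with low? i (suc k)
  ... | no ¬low = cong (λ x → x * 𝟙[ residue? ]) (sym (𝟙-≡0 (k <? ⌊ i /2⌋) λ k<h → ¬low (s≤s z≤n , ≤⌊/2⌋⇒+≤ k<h)))
    where residue? = (row-offset i + u * k) % m ≟ s
  ... | yes low@(_ , 2j≤i) with Low⇒orbitLength low
  ...   | t , refl , _ = begin
    1 * 𝟙[ hit? i (suc k) ]             ≡⟨ *-identityˡ _ ⟩
    𝟙[ hit? i (suc k) ]                 ≡⟨ 𝟙-cong (hit? i (suc k)) residue? (hit⇔residue k t) ⟩
    𝟙[ residue? ]                       ≡⟨ *-identityˡ _ ⟨
    1 * 𝟙[ residue? ]                   ≡⟨ cong (λ x → x * 𝟙[ residue? ]) (𝟙-≡1 (k <? ⌊ i /2⌋) (+≤⇒≤⌊/2⌋ 2j≤i)) ⟨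
    𝟙[ k <? ⌊ i /2⌋ ] * 𝟙[ residue? ] ∎
    where
    open ≡-Reasoning
    residue? = (row-offset i + u * k) % m ≟ s

  row≡hits : ∀ {M i} → i ≤ M → row M i ≡ hits (row-offset i) s ⌊ i /2⌋
  row≡hits {M} {i} i≤M = begin
    row M i
      ≡⟨⟩
    ∑[ k < M ] (𝟙[ low? i (suc k) ] * 𝟙[ hit? i (suc k) ])
      ≡⟨ ∑-cong M (λ {k} _ → row-term i k) ⟩
    ∑[ k < M ] (𝟙[ k <? ⌊ i /2⌋ ] * 𝟙[ (row-offset i + u * k) % m ≟ s ])
      ≡⟨ ∑-restrict _ (≤-trans (⌊n/2⌋≤n i) i≤M) ⟩
    hits (row-offset i) s ⌊ i /2⌋
      ∎
    where open ≡-Reasoning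

  Lower-approx : ∀ M → ∣ m * Lower M - ∑[ i < suc M ] ⌊ i /2⌋ ∣ ≤ suc M * m
  Lower-approx M = begin
    ∣ m * Lower M - ∑[ i < suc M ] ⌊ i /2⌋ ∣
      ≡⟨ cong (∣_- ∑[ i < suc M ] ⌊ i /2⌋ ∣) (*-distribˡ-∑ m (suc M) (row M)) ⟩
    ∣ ∑[ i < suc M ] (m * row M i) - ∑[ i < suc M ] ⌊ i /2⌋ ∣
      ≤⟨ ∑-∣-∣ (suc M) (λ i → m * row M i) ⌊_/2⌋ ⟩
    ∑[ i < suc M ] ∣ m * row M i - ⌊ i /2⌋ ∣
      ≤⟨ ∑-mono-≤ (suc M) (λ i<1+M → row-approx (m<1+n⇒m≤n i<1+M)) ⟩
    ∑[ i < suc M ] m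
      ≡⟨ ∑-const (suc M) m ⟩
    suc M * m
      ∎
    where
    open ≤-Reasoning
    row-approx : ∀ {i} → i ≤ M → ∣ m * row M i - ⌊ i /2⌋ ∣ ≤ m
    row-approx {i} i≤M = subst (λ n → ∣ m * n - ⌊ i /2⌋ ∣ ≤ m) (sym (row≡hits i≤M))
                               (hits-approx (row-offset i) s<m ⌊ i /2⌋)

  open Census d r using (Diagonal; Diagonal≤; N≡Diagonal+2Lower)

  2mN-approx : ∀ M → ∣ 2 * m * N r d M - 2 * suc M + 4 * ∑[ i < suc M ] ⌊ i /2⌋ ∣ ≤ 6 * m * suc M
  2mN-approx M = begin
    ∣ 2 * m * N r d M - 2 * n + 4 * H ∣
      ≡⟨ cong (λ k → ∣ k - 2 * n + 4 * H ∣) (trans (cong (2 * m *_) (N≡Diagonal+2Lower M)) (split m _ _)) ⟩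
    ∣ 2 * m * Diagonal M + 4 * (m * Lower M) - 2 * n + 4 * H ∣
      ≤⟨ ∣-∣-+ (2 * m * Diagonal M) (4 * (m * Lower M)) (2 * n) (4 * H) ⟩
    ∣ 2 * m * Diagonal M - 2 * n ∣ + ∣ 4 * (m * Lower M) - 4 * H ∣
      ≤⟨ +-mono-≤ diagonal-error lower-error ⟩
    2 * m * n + 4 * (n * m)
      ≡⟨ collect m n ⟩
    6 * m * n
      ∎
    where
    open ≤-Reasoning
    n = suc M
    H = ∑[ i < n ] ⌊ i /2⌋
    split : ∀ m D L → 2 * m * (D + L + L) ≡ 2 * m * D + 4 * (m * L)
    split = solve-∀
    collect : ∀ m n → 2 * m * n + 4 * (n * m) ≡ 6 * m * n
    collect = solve-∀
    diagonal-error : ∣ 2 * m * Diagonal M - 2 * n ∣ ≤ 2 * m * n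
    diagonal-error = ≤-trans (∣m-n∣≤m⊔n (2 * m * Diagonal M) (2 * n))
                             (⊔-lub (*-monoʳ-≤ (2 * m) (Diagonal≤ M)) (*-monoˡ-≤ n (*-monoʳ-≤ 2 (>-nonZero⁻¹ m))))
    lower-error : ∣ 4 * (m * Lower M) - 4 * H ∣ ≤ 4 * (n * m)
    lower-error = ≤-trans (≤-reflexive (sym (*-distribˡ-∣-∣ 4 (m * Lower M) H))) (*-monoʳ-≤ 4 (Lower-approx M))

  N-approx : ∀ M → 1 ≤ M → ∣ 2 * m * N r d M - M * M ∣ ≤ (12 * m + 4) * M
  N-approx M@(suc M′) _ = begin
    ∣ 2 * m * N r d M - M * M ∣
      ≤⟨ ∣-∣-triangle (2 * m * N r d M) (2 * suc M + 4 * ∑[ i < suc M ] ⌊ i /2⌋) (M * M) ⟩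
    ∣ 2 * m * N r d M - 2 * suc M + 4 * ∑[ i < suc M ] ⌊ i /2⌋ ∣ + ∣ 2 * suc M + 4 * ∑[ i < suc M ] ⌊ i /2⌋ - M * M ∣
      ≤⟨ +-mono-≤ (2mN-approx M) (∑⌊/2⌋-approx-M² M) ⟩
    6 * m * suc M + (2 * M + 2)
      ≤⟨ m≤m+n _ (6 * m * M′ + 2 * M′) ⟩
    6 * m * suc M + (2 * M + 2) + (6 * m * M′ + 2 * M′)
      ≡⟨ rearrange M′ m ⟩
    (12 * m + 4) * M
      ∎
    where
    open ≤-Reasoning
    rearrange : ∀ M′ m → 6 * m * (2 + M′) + (2 * suc M′ + 2) + (6 * m * M′ + 2 * M′) ≡ (12 * m + 4) * suc M′
    rearrange = solve-∀

module Cases where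

  open import Data.Nat
  open import Data.Nat.Properties
  open import Data.Nat.DivMod using (m%n*o≡m*o%[n*o])
  open import Data.Nat.Divisibility using (_∣_; divides; ∣-refl; ∣⇒≤; 0∣⇒≡0)
  open import Data.Nat.Coprimality using (Coprime; coprime-divisor)
  open import Data.Nat.Tactic.RingSolver using (solve-∀)
  open import Data.Integer as ℤ using (+_)
  import Data.Integer.Properties as ℤ
  open import Data.Product using (_×_; _,_; ∃)
  open import Data.Sum using (_⊎_; inj₁; inj₂)
  open import Data.Empty using (⊥-elim)
  open import Function using (_⇔_; mk⇔; id)
  open import Relation.Nullary using (¬_)
  open import Relation.Binary.PropositionalEquality

  ∣+-+∣≡∣-∣ : ∀ a b → ℤ.∣ + a ℤ.- + b ∣ ≡ ∣ a - b ∣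
  ∣+-+∣≡∣-∣ a b with ≤-total a b
  ... | inj₁ a≤b = trans (cong ℤ.∣_∣ (ℤ.m-n≡m⊖n a b)) (trans (ℤ.∣⊖∣-≤ a≤b) (sym (m≤n⇒∣m-n∣≡n∸m a≤b)))
  ... | inj₂ b≤a = trans (cong ℤ.∣_∣ (ℤ.m-n≡m⊖n a b))
                         (trans (ℤ.∣m⊖n∣≡∣n⊖m∣ a b) (trans (ℤ.∣⊖∣-≤ b≤a) (sym (m≤n⇒∣n-m∣≡n∸m b≤a))))

  ∣+*+-+∣≡∣*-∣ : ∀ a b c → ℤ.∣ + a ℤ.* + b ℤ.- + c ∣ ≡ ∣ a * b - c ∣
  ∣+*+-+∣≡∣*-∣ a b c = trans (cong (λ x → ℤ.∣ x ℤ.- + c ∣) (sym (ℤ.pos-* a b))) (∣+-+∣≡∣-∣ (a * b) c)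

  M^2≡M*M : ∀ M → M ^ 2 ≡ M * M
  M^2≡M*M M = cong (M *_) (*-identityʳ M)

  odd-coprime-2 : ∀ {q} → ¬ 2 ∣ q → Coprime q 2
  odd-coprime-2 _    {0}                 (_ , 0∣2)   = ⊥-elim (0≢1+n (sym (0∣⇒≡0 0∣2)))
  odd-coprime-2 _    {1}                 _           = refl
  odd-coprime-2 2∤q  {2}                 (2∣q , _)   = ⊥-elim (2∤q 2∣q)
  odd-coprime-2 _    {suc (suc (suc _))} (_ , i∣2)   with ∣⇒≤ i∣2
  ... | s≤s (s≤s ())

  %-cancel-factor : ∀ a q s g .{{_ : NonZero q}} .{{_ : NonZero g}} .{{_ : NonZero (q * g)}} →
                    (a * g) % (q * g) ≡ s * g ⇔ a % q ≡ s
  %-cancel-factor a q s g = mk⇔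
    (λ e → *-cancelʳ-≡ (a % q) s g (trans (m%n*o≡m*o%[n*o] a q g) e))
    (λ e → trans (sym (m%n*o≡m*o%[n*o] a q g)) (cong (_* g) e))

  N≡0-case : ∀ d r .{{_ : NonZero d}} → ((2 ∣ d × ¬ 4 ∣ d) × ¬ 2 ∣ r) ⊎ (4 ∣ d × ¬ 4 ∣ r) →
             ∀ M → N r d M ≡ 0
  N≡0-case d r (inj₁ ((2∣d , _) , 2∤r)) = Census.N≡0 d r (divides 2 refl) 2∣d 2∤r
  N≡0-case d r (inj₂ (4∣d , 4∤r))       = Census.N≡0 d r ∣-refl 4∣d 4∤r

  2∥d-case : ∀ d r .{{_ : NonZero d}} → r < d → (2 ∣ d × ¬ 4 ∣ d) × 2 ∣ r →
             ∃ λ C → ∀ M → 1 ≤ M → ℤ.∣ + d ℤ.* + N r d M ℤ.- + (M ^ 2) ∣ ≤ C * M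
  2∥d-case _ _ r<d ((divides q refl , 4∤d) , divides s refl) = 12 * q + 4 , λ M 1≤M → begin
    ℤ.∣ + (q * 2) ℤ.* + N (s * 2) (q * 2) M ℤ.- + (M ^ 2) ∣
      ≡⟨ ∣+*+-+∣≡∣*-∣ (q * 2) _ (M ^ 2) ⟩
    ∣ q * 2 * N (s * 2) (q * 2) M - M ^ 2 ∣
      ≡⟨ cong₂ (λ a b → ∣ a * N (s * 2) (q * 2) M - b ∣) (*-comm q 2) (M^2≡M*M M) ⟩
    ∣ 2 * q * N (s * 2) (q * 2) M - M * M ∣
      ≤⟨ LowCount.N-approx (q * 2) (s * 2) q 2 s s<q q-cancel reduction M 1≤M ⟩
    (12 * q + 4) * M
      ∎
    where
    open ≤-Reasoning
    instance
      q≢0 : NonZero q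
      q≢0 = m*n≢0⇒m≢0 q
    s<q : s < q
    s<q = *-cancelʳ-< 2 s q r<d
    q-cancel : ∀ {δ} → q ∣ 2 * δ → q ∣ δ
    q-cancel = coprime-divisor (odd-coprime-2 λ where (divides p refl) → 4∤d (divides p (*-assoc p 2 2)))
    reduction : ∀ ℓ → (4 * ℓ) % (q * 2) ≡ s * 2 ⇔ (2 * ℓ) % q ≡ s
    reduction ℓ = subst (λ x → x % (q * 2) ≡ s * 2 ⇔ (2 * ℓ) % q ≡ s) (sym (four ℓ))
                        (%-cancel-factor (2 * ℓ) q s 2)
      where four : ∀ ℓ → 4 * ℓ ≡ 2 * ℓ * 2
            four ℓ = trans (cong (_* ℓ) (*-comm 2 2)) (trans (*-assoc 2 2 ℓ) (*-comm 2 (2 * ℓ)))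

  4∣d-case : ∀ d r .{{_ : NonZero d}} → r < d → 4 ∣ d × 4 ∣ r →
             ∃ λ C → ∀ M → 1 ≤ M → ℤ.∣ + d ℤ.* + N r d M ℤ.- + (2 * M ^ 2) ∣ ≤ C * M
  4∣d-case _ _ r<d (divides q refl , divides s refl) = 2 * (12 * q + 4) , λ M 1≤M → begin
    ℤ.∣ + (q * 4) ℤ.* + N (s * 4) (q * 4) M ℤ.- + (2 * M ^ 2) ∣
      ≡⟨ ∣+*+-+∣≡∣*-∣ (q * 4) _ (2 * M ^ 2) ⟩
    ∣ q * 4 * N (s * 4) (q * 4) M - 2 * M ^ 2 ∣
      ≡⟨ cong₂ ∣_-_∣ (halve q (N (s * 4) (q * 4) M)) (cong (2 *_) (M^2≡M*M M)) ⟩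
    ∣ 2 * (2 * q * N (s * 4) (q * 4) M) - 2 * (M * M) ∣
      ≡⟨ *-distribˡ-∣-∣ 2 (2 * q * N (s * 4) (q * 4) M) (M * M) ⟨
    2 * ∣ 2 * q * N (s * 4) (q * 4) M - M * M ∣
      ≤⟨ *-monoʳ-≤ 2 (LowCount.N-approx (q * 4) (s * 4) q 1 s s<q q-cancel reduction M 1≤M) ⟩
    2 * ((12 * q + 4) * M)
      ≡⟨ *-assoc 2 (12 * q + 4) M ⟨
    2 * (12 * q + 4) * M
      ∎
    where
    open ≤-Reasoning
    instance
      q≢0 : NonZero q
      q≢0 = m*n≢0⇒m≢0 q
    halve : ∀ q n → q * 4 * n ≡ 2 * (2 * q * n)
    halve = solve-∀
    s<q : s < q
    s<q = *-cancelʳ-< 4 s q r<d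
    q-cancel : ∀ {δ} → q ∣ 1 * δ → q ∣ δ
    q-cancel {δ} = subst (q ∣_) (*-identityˡ δ)
    reduction : ∀ ℓ → (4 * ℓ) % (q * 4) ≡ s * 4 ⇔ (1 * ℓ) % q ≡ s
    reduction ℓ = subst (λ x → x % (q * 4) ≡ s * 4 ⇔ (1 * ℓ) % q ≡ s)
                        (trans (cong (_* 4) (*-identityˡ ℓ)) (*-comm ℓ 4)) (%-cancel-factor (1 * ℓ) q s 4)

  odd-case : ∀ d r .{{_ : NonZero d}} → r < d → ¬ 2 ∣ d →
             ∃ λ C → ∀ M → 1 ≤ M → ℤ.∣ + (2 * d) ℤ.* + N r d M ℤ.- + (M ^ 2) ∣ ≤ C * M
  odd-case d r r<d 2∤d = 12 * d + 4 , λ M 1≤M → begin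
    ℤ.∣ + (2 * d) ℤ.* + N r d M ℤ.- + (M ^ 2) ∣
      ≡⟨ ∣+*+-+∣≡∣*-∣ (2 * d) (N r d M) (M ^ 2) ⟩
    ∣ 2 * d * N r d M - M ^ 2 ∣
      ≡⟨ cong (∣ 2 * d * N r d M -_∣) (M^2≡M*M M) ⟩
    ∣ 2 * d * N r d M - M * M ∣
      ≤⟨ LowCount.N-approx d r d 4 r r<d d-cancel (λ _ → mk⇔ id id) M 1≤M ⟩
    (12 * d + 4) * M
      ∎
    where
    open ≤-Reasoning
    d-cancel : ∀ {δ} → d ∣ 4 * δ → d ∣ δ
    d-cancel {δ} d∣4δ = coprime-divisor (odd-coprime-2 2∤d)
                          (coprime-divisor (odd-coprime-2 2∤d) (subst (d ∣_) (*-assoc 2 2 δ) d∣4δ))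

open Cases using (N≡0-case; 2∥d-case; 4∣d-case; odd-case)
open import Data.Nat using (ℕ; _≤_; _<_; _^_; NonZero)
open import Data.Nat.Divisibility using (_∣_)
open import Data.Integer using (+_; _-_; _*_; ∣_∣)
open import Data.Product using (_×_; ∃; _,_)
open import Data.Sum using (_⊎_)
open import Relation.Nullary using (¬_)
open import Relation.Binary.PropositionalEquality using (_≡_)

theorem1p3 : (d r : ℕ) → .{{_ : NonZero d}} → 2 ≤ d → r < d →
    (((((2 ∣ d) × ¬ (4 ∣ d)) × ¬ (2 ∣ r)) ⊎ ((4 ∣ d) × ¬ (4 ∣ r))) →
    (M : ℕ) → 1 ≤ M → N r d M ≡ 0)
    × ((((2 ∣ d) × ¬ (4 ∣ d)) × (2 ∣ r)) →
    ∃ λ C → (M : ℕ) → 1 ≤ M → ∣ + d * + N r d M - + (M ^ 2) ∣ ≤ C Data.Nat.* M)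
    × (((4 ∣ d) × (4 ∣ r)) →
    ∃ λ C → (M : ℕ) → 1 ≤ M → ∣ + d * + N r d M - + (2 Data.Nat.* M ^ 2) ∣ ≤ C Data.Nat.* M)
    × (¬ (2 ∣ d) →
    ∃ λ C → (M : ℕ) → 1 ≤ M → ∣ + (2 Data.Nat.* d) * + N r d M - + (M ^ 2) ∣ ≤ C Data.Nat.* M)
theorem1p3 d r _ r<d =
  (λ h M _ → N≡0-case d r h M) , 2∥d-case d r r<d , 4∣d-case d r r<d , odd-case d r r<d
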